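{- Let $v>k$ be positive integers. If there exists a symmetric association scheme $\{A_i\}_{i=0}^5$ with $5$ classes whose first and second eigenmatrices (with respect to the ordering $A_0,\ldots,A_5$ of adjacency matrices and some ordering $E_0=\frac{1}{|X|}J,E_1,\ldots,E_5$ of primitive idempotents) are $$P=\left[\begin{array}{cccccc} 1&1&2(v-1)&k&k&2(v-k)\\ 1&-1&0&\sqrt{k}&-\sqrt{k}&0\\ 1&-1&0&-\sqrt{k}&\sqrt{k}&0\\ 1&1&2(v-1)&-k&-k&-2(v-k)\\ 1&1&-2&-\sqrt{\frac{(v-k)k}{v-1}}&-\sqrt{\frac{(v-k)k}{v-1}}&2\sqrt{\frac{(v-k)k}{v-1}}\\ 1&1&-2&\sqrt{\frac{(v-k)k}{v-1}}&\sqrt{\frac{(v-k)k}{v-1}}&-2\sqrt{\frac{(v-k)k}{v-1}} \end{array}\right],$$ $$Q=\left[\begin{array}{cccccc} 1&v&v&1&v-1&v-1\\ 1&-v&-v&1&v-1&v-1\\ 1&0&0&1&-1&-1\\ 1&\frac{v}{\sqrt{k}}&-\frac{v}{\sqrt{k}}&-1&-\sqrt{\frac{(v-1)(v-k)}{k}}&\sqrt{\frac{(v-1)(v-k)}{k}}\\ 1&-\frac{v}{\sqrt{k}}&\frac{v}{\sqrt{k}}&-1&-\sqrt{\frac{(v-1)(v-k)}{k}}&\sqrt{\frac{(v-1)(v-k)}{k}}\\ 1&0&0&-1&\sqrt{\frac{(v-1)k}{v-k}}&-\sqrt{\frac{(v-1)k}{v-k}} \end{array}\right],$$ then there exists a balanced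 weighing matrix with parameters $(v,k,\lambda)$, where $\lambda=\frac{k(k-1)}{v-1}$.
   Context: A symmetric association scheme with $n$ classes on a finite set $X$ is a family of nonzero $(0,1)$-matrices $A_0,\ldots,A_n$ indexed by $X$ with $A_0=I_{|X|}$, $\sum_iA_i=J_{|X|}$ (all-one matrix), $A_i^\top=A_i$ for all $i$, and $A_iA_j=\sum_kp_{ij}^kA_k$ for some integers $p_{ij}^k$. Their span has a basis of primitive idempotents $E_0=\frac{1}{|X|}J_{|X|},E_1,\ldots,E_n$; the first eigenmatrix $P=(p_{ij})$ and second eigenmatrix $Q=(q_{ij})$ are defined by $A_j=\sum_ip_{ij}E_i$ and $E_j=\frac{1}{|X|}\sum_iq_{ij}A_i$. A balanced weighing matrix with parameters $(v,k,\lambda)$ is a $v\times v$ matrix $W$ over $\{0,1,-1\}$ with $WW^\top=kI_v$ such that the entrywise absolute value $\overline{W}$ satisfies $\overline{W}\,\overline{W}^\top=(k-\lambda)I_v+\lambda J_v$, i.e. $\overline{W}$ is the incidence matrix of a symmetric $(v,k,\lambda)$ design. -}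

module Defs where

open import Level using (Level; _⊔_) renaming (suc to lsuc)
open import Algebra.Bundles using (CommutativeRing)
open import Data.Nat as ℕ using (ℕ; zero; suc; _∸_)
open import Data.Integer as ℤ using (ℤ; +_; ∣_∣)
open import Data.Fin using (Fin; zero; suc; _≟_)
open import Data.Vec using (Vec; []; _∷_; lookup)
open import Data.Product using (∃; ∃₂; _×_; _,_)
open import Data.Sum using (_⊎_)
open import Data.Bool using (if_then_else_)
open import Relation.Nullary using (¬_; does)
open import Relation.Binary.PropositionalEquality using (_≡_)

sumFin : ∀ {a} {A : Set a} → (A → A → A) → A → (n : ℕ) → (Fin n → A) → A
sumFin _+_ z zero    f = z
sumFin _+_ z (suc n) f = f zero + sumFin _+_ z n (λ i → f (suc i))

sumℕ : (n : ℕ) → (Fin n → ℕ) → ℕ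
sumℕ = sumFin ℕ._+_ 0

sumℤ : (n : ℕ) → (Fin n → ℤ) → ℤ
sumℤ = sumFin ℤ._+_ (+ 0)

δ : ∀ {n} → Fin n → Fin n → ℕ
δ x y = if does (x ≟ y) then 1 else 0

matMulℕ : ∀ {N} → (Fin N → Fin N → ℕ) → (Fin N → Fin N → ℕ) → Fin N → Fin N → ℕ
matMulℕ {N} A B x y = sumℕ N (λ z → A x z ℕ.* B z y)

record IsSymAssocScheme (d N : ℕ) (A : Fin (suc d) → Fin N → Fin N → ℕ) : Set where
  field
    zeroOne  : ∀ i x y → A i x y ≡ 0 ⊎ A i x y ≡ 1
    nonzero  : ∀ i → ∃₂ λ x y → A i x y ≡ 1
    A₀≡I     : ∀ x y → A zero x y ≡ δ x y
    sum≡J    : ∀ x y → sumℕ (suc d) (λ i → A i x y) ≡ 1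
    symmetric : ∀ i x y → A i x y ≡ A i y x
    closed   : ∃ λ (p : Fin (suc d) → Fin (suc d) → Fin (suc d) → ℤ) →
                 ∀ i j x y → + matMulℕ (A i) (A j) x y
                            ≡ sumℤ (suc d) (λ k → p i j k ℤ.* + A k x y)

record Field (c ℓ : Level) : Set (lsuc (c ⊔ ℓ)) where
  field
    commutativeRing : CommutativeRing c ℓ
  open CommutativeRing commutativeRing public
  field
    1≉0     : ¬ (1# ≈ 0#)
    inverse : ∀ x → ¬ (x ≈ 0#) → ∃ λ y → x * y ≈ 1#

module FieldOps {c ℓ} (F : Field c ℓ) where
  open Field F using (Carrier; _≈_; _+_; _*_; -_; 0#; 1#)

  ι : ℕ → Carrier
  ι zero    = 0#
  ι (suc n) = 1# + ι n

  CharacteristicZero : Set ℓ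
  CharacteristicZero = ∀ n → ¬ (ι (suc n) ≈ 0#)

  sumF : (n : ℕ) → (Fin n → Carrier) → Carrier
  sumF = sumFin _+_ 0#

  MatF : ℕ → Set c
  MatF N = Fin N → Fin N → Carrier

  mulF : ∀ {N} → MatF N → MatF N → MatF N
  mulF {N} M M' x y = sumF N (λ z → M x z * M' z y)

  InAlgebra : ∀ {d N} → (Fin (suc d) → Fin N → Fin N → ℕ) → MatF N → Set (c ⊔ ℓ)
  InAlgebra {d} A G = ∃ λ (γ : Fin (suc d) → Carrier) →
                        ∀ x y → G x y ≈ sumF (suc d) (λ i → γ i * ι (A i x y))

  record HasEigenmatrices (d N : ℕ) (A : Fin (suc d) → Fin N → Fin N → ℕ)
                          (P Q : Fin (suc d) → Fin (suc d) → Carrier) : Set (c ⊔ ℓ) where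
    field
      E          : Fin (suc d) → MatF N
      E-inAlg    : ∀ i → InAlgebra A (E i)
      E₀≡J/N     : ∀ x y → ι N * E zero x y ≈ 1#
      E-orthIdem : ∀ i j x y → mulF (E i) (E j) x y ≈ (if does (i ≟ j) then E i x y else 0#)
      E-nonzero  : ∀ i → ∃₂ λ x y → ¬ (E i x y ≈ 0#)
      E-primitive : ∀ i (G : MatF N) → InAlgebra A G →
                      (∀ x y → mulF G G x y ≈ G x y) →
                      (∀ x y → mulF G (E i) x y ≈ G x y) →
                      (∀ x y → G x y ≈ 0#) ⊎ (∀ x y → G x y ≈ E i x y)
      firstEigen  : ∀ j x y → ι (A j x y) ≈ sumF (suc d) (λ i → P i j * E i x y)
      secondEigen : ∀ j x y → ι N * E j x y ≈ sumF (suc d) (λ i → Q i j * ι (A i x y))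

  -- The matrices P and Q of the theorem.  Here
  --   s = √k,  t = √((v-k)k/(v-1)),
  --   a = v/√k,  b = √((v-1)(v-k)/k),  c' = √((v-1)k/(v-k)).
  Pmat : (v k : ℕ) (s t : Carrier) → Fin 6 → Fin 6 → Carrier
  Pmat v k s t i j = lookup (lookup rows i) j
    where
    rows : Vec (Vec Carrier 6) 6
    rows =
      (1# ∷ 1#   ∷ ι (2 ℕ.* (v ∸ 1)) ∷ ι k   ∷ ι k   ∷ ι (2 ℕ.* (v ∸ k)) ∷ []) ∷
      (1# ∷ - 1# ∷ 0#               ∷ s     ∷ - s   ∷ 0#               ∷ []) ∷
      (1# ∷ - 1# ∷ 0#               ∷ - s   ∷ s     ∷ 0#               ∷ []) ∷
      (1# ∷ 1#   ∷ ι (2 ℕ.* (v ∸ 1)) ∷ - ι k ∷ - ι k ∷ - ι (2 ℕ.* (v ∸ k)) ∷ []) ∷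
      (1# ∷ 1#   ∷ - ι 2            ∷ - t   ∷ - t   ∷ ι 2 * t          ∷ []) ∷
      (1# ∷ 1#   ∷ - ι 2            ∷ t     ∷ t     ∷ - (ι 2 * t)      ∷ []) ∷ []

  Qmat : (v : ℕ) (a b c' : Carrier) → Fin 6 → Fin 6 → Carrier
  Qmat v a b c' i j = lookup (lookup rows i) j
    where
    rows : Vec (Vec Carrier 6) 6
    rows =
      (1# ∷ ι v   ∷ ι v   ∷ 1#   ∷ ι (v ∸ 1) ∷ ι (v ∸ 1) ∷ []) ∷
      (1# ∷ - ι v ∷ - ι v ∷ 1#   ∷ ι (v ∸ 1) ∷ ι (v ∸ 1) ∷ []) ∷
      (1# ∷ 0#    ∷ 0#    ∷ 1#   ∷ - 1#      ∷ - 1#      ∷ []) ∷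
      (1# ∷ a     ∷ - a   ∷ - 1# ∷ - b       ∷ b         ∷ []) ∷
      (1# ∷ - a   ∷ a     ∷ - 1# ∷ - b       ∷ b         ∷ []) ∷
      (1# ∷ 0#    ∷ 0#    ∷ - 1# ∷ c'        ∷ - c'      ∷ []) ∷ []

record IsBalancedWeighing (v k λ' : ℕ) (W : Fin v → Fin v → ℤ) : Set where
  field
    entries  : ∀ x y → W x y ≡ + 0 ⊎ W x y ≡ + 1 ⊎ W x y ≡ ℤ.- (+ 1)
    WWᵀ≡kI   : ∀ x y → sumℤ v (λ z → W x z ℤ.* W y z) ≡ + (k ℕ.* δ x y)
    |W||W|ᵀ  : ∀ x y → sumℕ v (λ z → ∣ W x z ∣ ℕ.* ∣ W y z ∣)
                      ≡ (k ∸ λ') ℕ.* δ x y ℕ.+ λ'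

-- The first eigenmatrix P determines the Bose–Mesner algebra: in characteristic zero, an
-- identity between ℕ-combinations of products of the Aᵢ holds as soon as the corresponding
-- identity between their eigenvalues holds at every primitive idempotent. Reading off P, the
-- matrix A₁ is a perfect matching, A₃A₁ = A₄ and A₄A₁ = A₃, Same = A₀ + A₁ + A₂ satisfies Same² = 2v·Same,
-- (A₃ − A₄)² = 2k(I − A₁) and (v − 1)(A₃ + A₄)² = 2k((v − 1)(I + A₁) + (k − 1)A₂).
-- So Same is an equivalence relation whose classes have 2v points and are unions of matching edges,
-- and composing with the matching swaps A₃ and A₄. Fix a class, take one end of each matching edge
-- inside it as rows and one end of each matching edge outside it as columns (v of each), and let
-- W = A₃ − A₄ on rows × columns. A column sum over the whole scheme of a function invariant under
-- the matching and vanishing on the class counts each column twice, so the two square identities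
-- become WWᵀ = kI and |W||W|ᵀ = (k − λ)I + λJ with λ(v − 1) = k(k − 1).

module Submission where

open import Defs
open import Level using (Level)
open import Algebra.Bundles using (Semiring)
open import Data.Nat as ℕ using (ℕ; zero; suc)
import Data.Nat.Properties as ℕₚ
open import Data.Integer as ℤ using (ℤ; +_; -[1+_]; _⊖_; _◃_; sign; ∣_∣)
import Data.Integer.Properties as ℤₚ
open import Data.Sign as Sign using (Sign)
open import Data.Fin using (Fin; zero; suc; _≟_; #_)
open import Data.Fin.Properties using (suc-injective)
open import Data.Bool using (if_then_else_)
open import Data.Vec using ([]; _∷_; lookup)
open import Data.Maybe using (map)
open import Data.Empty using (⊥; ⊥-elim)
open import Data.Sum using (_⊎_; inj₁; inj₂)
open import Function using (_∘_)
open import Data.Fin.Permutation using (Permutation; _⟨$⟩ʳ_)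
open import Relation.Nullary using (does; yes; no)
open import Relation.Binary.Consequences using (dec⇒weaklyDec)
open import Relation.Binary.Definitions using (WeaklyDecidable; tri<; tri≈; tri>)
open import Relation.Binary.PropositionalEquality as ≡ using (_≡_; _≢_)
import Algebra.Solver.Ring.AlmostCommutativeRing as ACR
import Data.Nat.Tactic.RingSolver as NatSolver
import Data.Integer.Tactic.RingSolver as IntSolver

module FinSum {a ℓ} (R : Semiring a ℓ) where
  open Semiring R hiding (zero)
  open import Algebra.Properties.Semiring.Sum R as Lib using (sum)
  open import Relation.Binary.Reasoning.Setoid setoid

  ∑ : (n : ℕ) → (Fin n → Carrier) → Carrier
  ∑ = sumFin _+_ 0#

  ∑≡sum : ∀ n (f : Fin n → Carrier) → ∑ n f ≡ sum f
  ∑≡sum zero    f = ≡.refl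
  ∑≡sum (suc n) f = ≡.cong (_+_ (f zero)) (∑≡sum n (f ∘ suc))

  ∑-cong : ∀ n {f g : Fin n → Carrier} → (∀ i → f i ≈ g i) → ∑ n f ≈ ∑ n g
  ∑-cong n {f} {g} f≈g = begin
    ∑ n f ≡⟨ ∑≡sum n f ⟩
    sum f ≈⟨ Lib.sum-cong-≋ f≈g ⟩
    sum g ≡⟨ ≡.sym (∑≡sum n g) ⟩
    ∑ n g ∎

  ∑-zero : ∀ n {f : Fin n → Carrier} → (∀ i → f i ≈ 0#) → ∑ n f ≈ 0#
  ∑-zero n f≈0 = trans (∑-cong n f≈0) (trans (reflexive (∑≡sum n _)) (Lib.sum-replicate-zero n))

  ∑-distrib-+ : ∀ n (f g : Fin n → Carrier) → ∑ n (λ i → f i + g i) ≈ ∑ n f + ∑ n g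
  ∑-distrib-+ n f g = begin
    ∑ n (λ i → f i + g i) ≡⟨ ∑≡sum n _ ⟩
    sum (λ i → f i + g i) ≈⟨ Lib.∑-distrib-+ f g ⟩
    sum f + sum g         ≡⟨ ≡.sym (≡.cong₂ _+_ (∑≡sum n f) (∑≡sum n g)) ⟩
    ∑ n f + ∑ n g         ∎

  ∑-comm : ∀ m n (f : Fin m → Fin n → Carrier) →
           ∑ m (λ i → ∑ n (f i)) ≈ ∑ n (λ j → ∑ m (λ i → f i j))
  ∑-comm zero    n f = sym (∑-zero n (λ _ → refl))
  ∑-comm (suc m) n f = trans (+-congˡ (∑-comm m n (f ∘ suc))) (sym (∑-distrib-+ n (f zero) _))

  *-distribˡ-∑ : ∀ n x (f : Fin n → Carrier) → x * ∑ n f ≈ ∑ n (λ i → x * f i)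
  *-distribˡ-∑ n x f = begin
    x * ∑ n f            ≡⟨ ≡.cong (x *_) (∑≡sum n f) ⟩
    x * sum f            ≈⟨ Lib.*-distribˡ-sum x f ⟩
    sum (λ i → x * f i)  ≡⟨ ≡.sym (∑≡sum n _) ⟩
    ∑ n (λ i → x * f i)  ∎

  *-distribʳ-∑ : ∀ n x (f : Fin n → Carrier) → ∑ n f * x ≈ ∑ n (λ i → f i * x)
  *-distribʳ-∑ n x f = begin
    ∑ n f * x            ≡⟨ ≡.cong (_* x) (∑≡sum n f) ⟩
    sum f * x            ≈⟨ Lib.*-distribʳ-sum x f ⟩
    sum (λ i → f i * x)  ≡⟨ ≡.sym (∑≡sum n _) ⟩
    ∑ n (λ i → f i * x)  ∎

  ∑-*-∑ : ∀ m n (f : Fin m → Carrier) (g : Fin n → Carrier) →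
          ∑ m f * ∑ n g ≈ ∑ m (λ i → ∑ n (λ j → f i * g j))
  ∑-*-∑ m n f g = trans (*-distribʳ-∑ m (∑ n g) f) (∑-cong m (λ i → *-distribˡ-∑ n (f i) g))

  ∑-permute : ∀ n (f : Fin n → Carrier) (π : Permutation n n) → ∑ n f ≈ ∑ n (f ∘ (π ⟨$⟩ʳ_))
  ∑-permute n f π = begin
    ∑ n f                   ≡⟨ ∑≡sum n f ⟩
    sum f                   ≈⟨ Lib.sum-permute f π ⟩
    sum (f ∘ (π ⟨$⟩ʳ_))     ≡⟨ ≡.sym (∑≡sum n _) ⟩
    ∑ n (f ∘ (π ⟨$⟩ʳ_))     ∎

  ∑-select : ∀ n (f : Fin n → Carrier) c → (∀ i → i ≢ c → f i ≈ 0#) → ∑ n f ≈ f c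
  ∑-select (suc n) f zero    off = trans (+-congˡ (∑-zero n (λ i → off (suc i) λ ()))) (+-identityʳ _)
  ∑-select (suc n) f (suc c) off = trans (+-congʳ (off zero λ ())) (trans (+-identityˡ _)
    (∑-select n (f ∘ suc) c (λ i i≢c → off (suc i) (i≢c ∘ suc-injective))))

module ℕΣ = FinSum ℕₚ.+-*-semiring
module ℤΣ = FinSum ℤₚ.+-*-semiring

module FieldArithmetic {c ℓ} (F : Field c ℓ) where
  open Field F hiding (zero)
  open FieldOps F
  open import Algebra.Properties.Ring ring
  open import Algebra.Properties.Semiring.Mult semiring using (_×_; ×-homo-+; ×1-homo-*)
  open import Relation.Binary.Reasoning.Setoid setoid

  ι≈×1 : ∀ n → ι n ≈ n × 1#
  ι≈×1 zero    = refl
  ι≈×1 (suc n) = +-congˡ (ι≈×1 n)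

  ι-homo-+ : ∀ m n → ι (m ℕ.+ n) ≈ ι m + ι n
  ι-homo-+ m n = trans (ι≈×1 (m ℕ.+ n)) (trans (×-homo-+ 1# m n) (sym (+-cong (ι≈×1 m) (ι≈×1 n))))

  ι-homo-* : ∀ m n → ι (m ℕ.* n) ≈ ι m * ι n
  ι-homo-* m n = trans (ι≈×1 (m ℕ.* n)) (trans (×1-homo-* m n) (sym (*-cong (ι≈×1 m) (ι≈×1 n))))

  ι-injective : CharacteristicZero → ∀ m n → ι m ≈ ι n → m ≡ n
  ι-injective char0 zero    zero    _   = ≡.refl
  ι-injective char0 zero    (suc n) eq  = ⊥-elim (char0 n (sym eq))
  ι-injective char0 (suc m) zero    eq  = ⊥-elim (char0 m eq)
  ι-injective char0 (suc m) (suc n) eq  = ≡.cong suc (ι-injective char0 m n (+-cancelˡ 1# (ι m) (ι n) eq))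

  ιℤ : ℤ → Carrier
  ιℤ (+ n)      = ι n
  ιℤ -[1+ n ]   = - ι (suc n)

  [1+x]-[1+y]≈x-y : ∀ x y → (1# + x) - (1# + y) ≈ x - y
  [1+x]-[1+y]≈x-y x y = begin
    (1# + x) - (1# + y)     ≈⟨ +-cong (+-comm 1# x) (sym (-‿+-comm 1# y)) ⟩
    (x + 1#) + (- 1# - y)   ≈⟨ +-assoc x 1# _ ⟩
    x + (1# + (- 1# - y))   ≈⟨ +-congˡ (sym (+-assoc 1# (- 1#) _)) ⟩
    x + ((1# - 1#) - y)     ≈⟨ +-congˡ (+-congʳ (-‿inverseʳ 1#)) ⟩
    x + (0# - y)            ≈⟨ +-congˡ (+-identityˡ _) ⟩
    x - y                   ∎

  ιℤ-⊖ : ∀ m n → ιℤ (m ⊖ n) ≈ ι m - ι n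
  ιℤ-⊖ m       zero    = sym (trans (+-congˡ -0#≈0#) (+-identityʳ _))
  ιℤ-⊖ zero    (suc n) = sym (+-identityˡ _)
  ιℤ-⊖ (suc m) (suc n) = begin
    ιℤ (suc m ⊖ suc n)                   ≡⟨ ≡.cong ιℤ (ℤₚ.[1+m]⊖[1+n]≡m⊖n m n) ⟩
    ιℤ (m ⊖ n)                           ≈⟨ ιℤ-⊖ m n ⟩
    ι m - ι n                           ≈⟨ sym ([1+x]-[1+y]≈x-y (ι m) (ι n)) ⟩
    ι (suc m) - ι (suc n)               ∎

  ιℤ-homo-+ : ∀ i j → ιℤ (i ℤ.+ j) ≈ ιℤ i + ιℤ j
  ιℤ-homo-+ (+ m)      (+ n)      = ι-homo-+ m n
  ιℤ-homo-+ (+ m)      -[1+ n ]   = ιℤ-⊖ m (suc n)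
  ιℤ-homo-+ -[1+ m ]   (+ n)      = trans (ιℤ-⊖ n (suc m)) (+-comm _ _)
  ιℤ-homo-+ -[1+ m ]   -[1+ n ]   = begin
    - ι (suc (suc (m ℕ.+ n)))       ≡⟨ ≡.cong (λ n → - ι n) (≡.sym (ℕₚ.+-suc (suc m) n)) ⟩
    - ι (suc m ℕ.+ suc n)           ≈⟨ -‿cong (ι-homo-+ (suc m) (suc n)) ⟩
    - (ι (suc m) + ι (suc n))       ≈⟨ sym (-‿+-comm _ _) ⟩
    - ι (suc m) + - ι (suc n)       ∎

  ιℤ-homo-neg : ∀ i → ιℤ (ℤ.- i) ≈ - ιℤ i
  ιℤ-homo-neg (+ zero)    = sym -0#≈0#
  ιℤ-homo-neg (+ suc n)   = refl
  ιℤ-homo-neg -[1+ n ]    = sym (-‿involutive _)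

  signed : Sign → Carrier → Carrier
  signed Sign.+ x = x
  signed Sign.- x = - x

  signed-cong : ∀ s {x y} → x ≈ y → signed s x ≈ signed s y
  signed-cong Sign.+ = λ e → e
  signed-cong Sign.- = -‿cong

  ιℤ-◃ : ∀ s n → ιℤ (s ◃ n) ≈ signed s (ι n)
  ιℤ-◃ Sign.+ zero    = refl
  ιℤ-◃ Sign.- zero    = sym -0#≈0#
  ιℤ-◃ Sign.+ (suc n) = refl
  ιℤ-◃ Sign.- (suc n) = refl

  signed-* : ∀ s t x y → signed (s Sign.* t) (x * y) ≈ signed s x * signed t y
  signed-* Sign.+ Sign.+ x y = refl
  signed-* Sign.+ Sign.- x y = -‿distribʳ-* x y
  signed-* Sign.- Sign.+ x y = -‿distribˡ-* x y
  signed-* Sign.- Sign.- x y = begin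
    x * y          ≈⟨ *-congʳ (sym (-‿involutive x)) ⟩
    - (- x) * y    ≈⟨ sym (-‿distribˡ-* (- x) y) ⟩
    - (- x * y)    ≈⟨ -‿distribʳ-* (- x) y ⟩
    - x * - y      ∎

  ιℤ-signed : ∀ i → ιℤ i ≈ signed (sign i) (ι ∣ i ∣)
  ιℤ-signed (+ n)      = refl
  ιℤ-signed -[1+ n ]   = refl

  ιℤ-homo-* : ∀ i j → ιℤ (i ℤ.* j) ≈ ιℤ i * ιℤ j
  ιℤ-homo-* i j = begin
    ιℤ (sign i Sign.* sign j ◃ ∣ i ∣ ℕ.* ∣ j ∣)                ≈⟨ ιℤ-◃ (sign i Sign.* sign j) (∣ i ∣ ℕ.* ∣ j ∣) ⟩
    signed (sign i Sign.* sign j) (ι (∣ i ∣ ℕ.* ∣ j ∣))       ≈⟨ signed-cong (sign i Sign.* sign j) (ι-homo-* ∣ i ∣ ∣ j ∣) ⟩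
    signed (sign i Sign.* sign j) (ι ∣ i ∣ * ι ∣ j ∣)         ≈⟨ signed-* (sign i) (sign j) _ _ ⟩
    signed (sign i) (ι ∣ i ∣) * signed (sign j) (ι ∣ j ∣)     ≈⟨ sym (*-cong (ιℤ-signed i) (ιℤ-signed j)) ⟩
    ιℤ i * ιℤ j                                             ∎

  ι₁ : ℕ → Carrier
  ι₁ zero          = 0#
  ι₁ (suc zero)    = 1#
  ι₁ (suc (suc n)) = ι (suc (suc n))

  ι₁≈ι : ∀ n → ι₁ n ≈ ι n
  ι₁≈ι zero          = refl
  ι₁≈ι (suc zero)    = sym (+-identityʳ 1#)
  ι₁≈ι (suc (suc n)) = refl

  -- Sends 1 to 1# itself rather than to ι 1 = 1# + 0#, so that the constants 1# and - 1#
  -- of a goal are literally images of solver constants.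
  fromℤ : ℤ → Carrier
  fromℤ (+ n)      = ι₁ n
  fromℤ -[1+ n ]   = - ι₁ (suc n)

  fromℤ≈ιℤ : ∀ i → fromℤ i ≈ ιℤ i
  fromℤ≈ιℤ (+ n)      = ι₁≈ι n
  fromℤ≈ιℤ -[1+ n ]   = -‿cong (ι₁≈ι (suc n))

  ℤ⟶F : ACR._-Raw-AlmostCommutative⟶_ ℤ.+-*-rawRing (ACR.fromCommutativeRing commutativeRing)
  ℤ⟶F = record
    { ⟦_⟧    = fromℤ
    ; +-homo = λ i j → via-ιℤ (i ℤ.+ j) (ιℤ-homo-+ i j) (+-cong (fromℤ≈ιℤ i) (fromℤ≈ιℤ j))
    ; *-homo = λ i j → via-ιℤ (i ℤ.* j) (ιℤ-homo-* i j) (*-cong (fromℤ≈ιℤ i) (fromℤ≈ιℤ j))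
    ; -‿homo = λ i → via-ιℤ (ℤ.- i) (ιℤ-homo-neg i) (-‿cong (fromℤ≈ιℤ i))
    ; 0-homo = refl
    ; 1-homo = refl
    }
    where
    via-ιℤ : ∀ i {x y} → ιℤ i ≈ y → x ≈ y → fromℤ i ≈ x
    via-ιℤ i e x≈y = trans (fromℤ≈ιℤ i) (trans e (sym x≈y))

  ℤ-weaklyDecidable : WeaklyDecidable (ACR.Induced-equivalence ℤ⟶F)
  ℤ-weaklyDecidable i j = map (λ { ≡.refl → refl }) (dec⇒weaklyDec ℤ._≟_ i j)

  open import Algebra.Solver.Ring ℤ.+-*-rawRing (ACR.fromCommutativeRing commutativeRing) ℤ⟶F ℤ-weaklyDecidable
    public using (solve; _:=_; con; _:+_; _:*_; :-_; _:-_)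

  x*-1≈-x : ∀ x → x * - 1# ≈ - x
  x*-1≈-x x = trans (sym (-‿distribʳ-* x 1#)) (-‿cong (*-identityʳ x))

  -x*-1≈x : ∀ x → - x * - 1# ≈ x
  -x*-1≈x x = trans (x*-1≈-x (- x)) (-‿involutive x)

  ≈-modulo : ∀ {L R} c {a b} → L ≈ R + c * (a - b) → a ≈ b → L ≈ R
  ≈-modulo {L} {R} c {a} {b} L≈R+c[a-b] a≈b = begin
    L                ≈⟨ L≈R+c[a-b] ⟩
    R + c * (a - b)  ≈⟨ +-congˡ (*-congˡ (+-congʳ a≈b)) ⟩
    R + c * (b - b)  ≈⟨ +-congˡ (*-congˡ (-‿inverseʳ b)) ⟩
    R + c * 0#       ≈⟨ +-congˡ (zeroʳ c) ⟩
    R + 0#           ≈⟨ +-identityʳ R ⟩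
    R                ∎

  ≈-modulo₂ : ∀ {L R} c {a b} c' {a' b'} → L ≈ R + (c * (a - b) + c' * (a' - b')) → a ≈ b → a' ≈ b' → L ≈ R
  ≈-modulo₂ {L} {R} c c' eq a≈b a'≈b' =
    ≈-modulo c' (≈-modulo c (trans eq (solve 3 (λ r x y → r :+ (x :+ y) := (r :+ y) :+ x) refl R _ _)) a≈b) a'≈b'

  ι-∑ : ∀ n (f : Fin n → ℕ) → ι (sumℕ n f) ≈ sumF n (ι ∘ f)
  ι-∑ zero    f = refl
  ι-∑ (suc n) f = trans (ι-homo-+ (f zero) _) (+-congˡ (ι-∑ n (f ∘ suc)))

module Spectral {c ℓ} (F : Field c ℓ) {N d : ℕ} (E : Fin d → FieldOps.MatF F N)
  (E-orthIdem : ∀ i j x y → Field._≈_ F (FieldOps.mulF F (E i) (E j) x y)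
                                         (if does (i ≟ j) then E i x y else Field.0# F)) where
  open Field F hiding (zero)
  open FieldOps F
  open FieldArithmetic F
  open FinSum semiring
  open import Relation.Binary.Reasoning.Setoid setoid

  record HasEigenvalues (M : Fin N → Fin N → ℕ) (α : Fin d → Carrier) : Set ℓ where
    constructor eigen
    field decomposition : ∀ x y → ι (M x y) ≈ ∑ d (λ l → α l * E l x y)
  open HasEigenvalues

  eigen-cong : ∀ {M α β} → (∀ l → α l ≈ β l) → HasEigenvalues M α → HasEigenvalues M β
  eigen-cong α≈β (eigen hM) = eigen λ x y → trans (hM x y) (∑-cong d (λ l → *-congʳ (α≈β l)))

  eigen-+ : ∀ {M M' α β} → HasEigenvalues M α → HasEigenvalues M' β →
            HasEigenvalues (λ x y → M x y ℕ.+ M' x y) (λ l → α l + β l)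
  eigen-+ {M} {M'} {α} {β} (eigen hM) (eigen hM') = eigen λ x y → begin
    ι (M x y ℕ.+ M' x y)                                    ≈⟨ ι-homo-+ (M x y) (M' x y) ⟩
    ι (M x y) + ι (M' x y)                                  ≈⟨ +-cong (hM x y) (hM' x y) ⟩
    ∑ d (λ l → α l * E l x y) + ∑ d (λ l → β l * E l x y)   ≈⟨ sym (∑-distrib-+ d _ _) ⟩
    ∑ d (λ l → α l * E l x y + β l * E l x y)               ≈⟨ ∑-cong d (λ l → sym (distribʳ _ _ _)) ⟩
    ∑ d (λ l → (α l + β l) * E l x y)                       ∎

  eigen-scale : ∀ {M α} m → HasEigenvalues M α →
                HasEigenvalues (λ x y → m ℕ.* M x y) (λ l → ι m * α l)
  eigen-scale {M} {α} m (eigen hM) = eigen λ x y → begin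
    ι (m ℕ.* M x y)                       ≈⟨ ι-homo-* m (M x y) ⟩
    ι m * ι (M x y)                       ≈⟨ *-congˡ (hM x y) ⟩
    ι m * ∑ d (λ l → α l * E l x y)       ≈⟨ *-distribˡ-∑ d (ι m) _ ⟩
    ∑ d (λ l → ι m * (α l * E l x y))     ≈⟨ ∑-cong d (λ l → sym (*-assoc _ _ _)) ⟩
    ∑ d (λ l → (ι m * α l) * E l x y)     ∎

  eigen-mul : ∀ {M M' α β} → HasEigenvalues M α → HasEigenvalues M' β →
              HasEigenvalues (matMulℕ M M') (λ l → α l * β l)
  eigen-mul {M} {M'} {α} {β} (eigen hM) (eigen hM') = eigen λ x y → begin
    ι (matMulℕ M M' x y)
      ≈⟨ ι-∑ N _ ⟩
    ∑ N (λ z → ι (M x z ℕ.* M' z y))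
      ≈⟨ ∑-cong N (λ z → trans (ι-homo-* (M x z) (M' z y)) (*-cong (hM x z) (hM' z y))) ⟩
    ∑ N (λ z → ∑ d (λ l → α l * E l x z) * ∑ d (λ m → β m * E m z y))
      ≈⟨ ∑-cong N (λ z → ∑-*-∑ d d _ _) ⟩
    ∑ N (λ z → ∑ d (λ l → ∑ d (λ m → (α l * E l x z) * (β m * E m z y))))
      ≈⟨ trans (∑-comm N d _) (∑-cong d (λ l → ∑-comm N d _)) ⟩
    ∑ d (λ l → ∑ d (λ m → ∑ N (λ z → (α l * E l x z) * (β m * E m z y))))
      ≈⟨ ∑-cong d (λ l → ∑-cong d (λ m → factor (α l) (β m) (λ z → E l x z) (λ z → E m z y))) ⟩
    ∑ d (λ l → ∑ d (λ m → (α l * β m) * mulF (E l) (E m) x y))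
      ≈⟨ ∑-cong d (λ l → ∑-select d _ l (λ m m≢l → trans (*-congˡ (mulF-orthogonal m≢l)) (zeroʳ _))) ⟩
    ∑ d (λ l → (α l * β l) * mulF (E l) (E l) x y)
      ≈⟨ ∑-cong d (λ l → *-congˡ mulF-idempotent) ⟩
    ∑ d (λ l → (α l * β l) * E l x y)
      ∎
    where
    factor : ∀ a b (f g : Fin N → Carrier) → ∑ N (λ z → (a * f z) * (b * g z)) ≈ (a * b) * ∑ N (λ z → f z * g z)
    factor a b f g = trans (∑-cong N (λ z → solve 4 (λ a b p q → (a :* p) :* (b :* q) := (a :* b) :* (p :* q)) refl a b (f z) (g z)))
                           (sym (*-distribˡ-∑ N (a * b) _))
    mulF-orthogonal : ∀ {l m x y} → m ≢ l → mulF (E l) (E m) x y ≈ 0#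
    mulF-orthogonal {l} {m} {x} {y} m≢l with l ≟ m | E-orthIdem l m x y
    ... | yes l≡m | _  = ⊥-elim (m≢l (≡.sym l≡m))
    ... | no _    | eq = eq
    mulF-idempotent : ∀ {l x y} → mulF (E l) (E l) x y ≈ E l x y
    mulF-idempotent {l} {x} {y} with l ≟ l | E-orthIdem l l x y
    ... | yes _  | eq = eq
    ... | no l≢l | _  = ⊥-elim (l≢l ≡.refl)

  eigen-injective : CharacteristicZero → ∀ {M M' α β} → HasEigenvalues M α → HasEigenvalues M' β →
                    (∀ l → α l ≈ β l) → ∀ x y → M x y ≡ M' x y
  eigen-injective char0 {M} {M'} (eigen hM) hM' α≈β x y =
    ι-injective char0 (M x y) (M' x y) (trans (hM x y) (sym (decomposition (eigen-cong (sym ∘ α≈β) hM') x y)))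

module Scheme {N : ℕ} (A : Fin 6 → Fin N → Fin N → ℕ) where
  open import Data.Nat using (_+_; _*_; _∸_)

  A₀ A₁ A₂ A₃ A₄ A₅ Same Other : Fin N → Fin N → ℕ
  A₀ = A (# 0)
  A₁ = A (# 1)
  A₂ = A (# 2)
  A₃ = A (# 3)
  A₄ = A (# 4)
  A₅ = A (# 5)
  Same  x y = (A₀ x y + A₁ x y) + A₂ x y
  Other x y = (A₃ x y + A₄ x y) + A₅ x y

  _·_ : (Fin N → Fin N → ℕ) → (Fin N → Fin N → ℕ) → Fin N → Fin N → ℕ
  _·_ = matMulℕ

  -- The last two fields are the two square identities of the proof, rearranged so that no subtraction occurs.
  record WeighingRelations (v k : ℕ) : Set where
    field
      A₁-rowSum     : ∀ x → sumℕ N (A₁ x) ≡ 1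
      Same-rowSum   : ∀ x → sumℕ N (Same x) ≡ 2 * v
      Other-rowSum  : ∀ x → sumℕ N (Other x) ≡ 2 * v
      A₃A₁≡A₄       : ∀ x y → (A₃ · A₁) x y ≡ A₄ x y
      A₄A₁≡A₃       : ∀ x y → (A₄ · A₁) x y ≡ A₃ x y
      Same²≡2v·Same : ∀ x y → (Same · Same) x y ≡ (2 * v) * Same x y
      difference²   : ∀ x y → ((A₃ · A₃) x y + (A₄ · A₄) x y) + k * (2 * A₁ x y)
                            ≡ ((A₃ · A₄) x y + (A₄ · A₃) x y) + k * (2 * A₀ x y)
      sum²          : ∀ x y → (v ∸ 1) * ((((A₃ · A₃) x y + (A₃ · A₄) x y) + (A₄ · A₃) x y) + (A₄ · A₄) x y)
                            ≡ k * (2 * ((v ∸ 1) * (A₀ x y + A₁ x y))) + k * (2 * ((k ∸ 1) * A₂ x y))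

module EigenmatrixRelations {c ℓ} (F : Field c ℓ) (char0 : FieldOps.CharacteristicZero F)
  (v k : ℕ) (0<k : 0 ℕ.< k) (k<v : k ℕ.< v) (s t : Field.Carrier F)
  (s² : Field._≈_ F (Field._*_ F s s) (FieldOps.ι F k))
  (t² : Field._≈_ F (Field._*_ F (FieldOps.ι F (v ℕ.∸ 1)) (Field._*_ F t t)) (FieldOps.ι F ((v ℕ.∸ k) ℕ.* k)))
  {N : ℕ} {A : Fin 6 → Fin N → Fin N → ℕ} {Q : Fin 6 → Fin 6 → Field.Carrier F}
  (H : FieldOps.HasEigenmatrices F 5 N A (FieldOps.Pmat F v k s t) Q) where
  open Field F hiding (zero)
  open FieldOps F
  open FieldArithmetic F
  open FinSum semiring
  open HasEigenmatrices H
  open Spectral F E E-orthIdem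
  open Scheme A
  open import Relation.Binary.Reasoning.Setoid setoid

  P : Fin 6 → Fin 6 → Carrier
  P = Pmat v k s t

  by-rows : {Goal : Fin 6 → Set ℓ} → Goal (# 0) → Goal (# 1) → Goal (# 2) → Goal (# 3) → Goal (# 4) → Goal (# 5) → ∀ l → Goal l
  by-rows g₀ g₁ g₂ g₃ g₄ g₅ zero                                = g₀
  by-rows g₀ g₁ g₂ g₃ g₄ g₅ (suc zero)                          = g₁
  by-rows g₀ g₁ g₂ g₃ g₄ g₅ (suc (suc zero))                    = g₂
  by-rows g₀ g₁ g₂ g₃ g₄ g₅ (suc (suc (suc zero)))              = g₃
  by-rows g₀ g₁ g₂ g₃ g₄ g₅ (suc (suc (suc (suc zero))))        = g₄
  by-rows g₀ g₁ g₂ g₃ g₄ g₅ (suc (suc (suc (suc (suc zero))))) = g₅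

  eigen-A : ∀ j → HasEigenvalues (A j) (λ l → P l j)
  eigen-A j = eigen (firstEigen j)

  e₀ : Fin 6 → Carrier
  e₀ zero    = ι N
  e₀ (suc _) = 0#

  eigen-J : HasEigenvalues (λ _ _ → 1) e₀
  eigen-J = eigen λ x y → begin
    1# + 0#                                      ≈⟨ +-identityʳ 1# ⟩
    1#                                           ≈⟨ sym (E₀≡J/N x y) ⟩
    ι N * E zero x y                             ≈⟨ sym (+-identityʳ _) ⟩
    ι N * E zero x y + 0#                        ≈⟨ +-congˡ (sym (∑-zero 5 (λ l → zeroˡ (E (suc l) x y)))) ⟩
    ι N * E zero x y + ∑ 5 (λ l → 0# * E (suc l) x y) ∎

  valency : Fin 6 → ℕ
  valency j = lookup (1 ∷ 1 ∷ 2 ℕ.* (v ℕ.∸ 1) ∷ k ∷ k ∷ 2 ℕ.* (v ℕ.∸ k) ∷ []) j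

  P₀≈valency : ∀ j → P zero j ≈ ι (valency j)
  P₀≈valency = by-rows (sym (+-identityʳ 1#)) (sym (+-identityʳ 1#)) refl refl refl refl

  A-rowSum : ∀ j x → sumℕ N (A j x) ≡ valency j
  A-rowSum j x = ≡.trans (ℕΣ.∑-cong N (λ z → ≡.sym (ℕₚ.*-identityʳ (A j x z))))
                         (≡.trans (AJ≡valency·J x x) (ℕₚ.*-identityʳ (valency j)))
    where
    AJ≡valency·J : ∀ x y → matMulℕ (A j) (λ _ _ → 1) x y ≡ valency j ℕ.* 1
    AJ≡valency·J = eigen-injective char0 (eigen-mul (eigen-A j) eigen-J) (eigen-scale (valency j) eigen-J) coeff
      where
      coeff : ∀ l → P l j * e₀ l ≈ ι (valency j) * e₀ l
      coeff zero    = *-congʳ (P₀≈valency j)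
      coeff (suc l) = trans (zeroʳ _) (sym (zeroʳ _))

  K K₁ V₁ Vₖ : Carrier
  K  = ι k
  K₁ = ι (k ℕ.∸ 1)
  V₁ = ι (v ℕ.∸ 1)
  Vₖ = ι (v ℕ.∸ k)

  K≈1+K₁ : K ≈ 1# + K₁
  K≈1+K₁ = reflexive (≡.cong ι (≡.sym (ℕₚ.suc-pred k {{ℕ.>-nonZero 0<k}})))

  V₁≈Vₖ+K₁ : V₁ ≈ Vₖ + K₁
  V₁≈Vₖ+K₁ = trans (reflexive (≡.cong ι (v∸1≡[v∸k]+[k∸1] 0<k k<v))) (ι-homo-+ (v ℕ.∸ k) (k ℕ.∸ 1))
    where
    v∸1≡[v∸k]+[k∸1] : ∀ {v k} → 0 ℕ.< k → k ℕ.< v → v ℕ.∸ 1 ≡ (v ℕ.∸ k) ℕ.+ (k ℕ.∸ 1)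
    v∸1≡[v∸k]+[k∸1] {suc v} {suc k} _ (ℕ.s≤s k<v) = ≡.sym (ℕₚ.m∸n+n≡m (ℕₚ.<⇒≤ k<v))

  V₁t²≈VₖK : V₁ * (t * t) ≈ Vₖ * K
  V₁t²≈VₖK = trans t² (ι-homo-* (v ℕ.∸ k) k)

  ι[2[v∸1]]≈2V₁ : ι (2 ℕ.* (v ℕ.∸ 1)) ≈ ι 2 * V₁
  ι[2[v∸1]]≈2V₁ = ι-homo-* 2 (v ℕ.∸ 1)

  2v≡2+2[v∸1] : 2 ℕ.* v ≡ 2 ℕ.+ 2 ℕ.* (v ℕ.∸ 1)
  2v≡2+2[v∸1] = lemma (ℕₚ.<-trans 0<k k<v)
    where
    lemma : ∀ {v} → 0 ℕ.< v → 2 ℕ.* v ≡ 2 ℕ.+ 2 ℕ.* (v ℕ.∸ 1)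
    lemma {suc v} _ = ℕₚ.*-suc 2 v

  ι[2v]≈2+ι[2[v∸1]] : ι (2 ℕ.* v) ≈ ι 2 + ι (2 ℕ.* (v ℕ.∸ 1))
  ι[2v]≈2+ι[2[v∸1]] = trans (reflexive (≡.cong ι 2v≡2+2[v∸1])) (ι-homo-+ 2 (2 ℕ.* (v ℕ.∸ 1)))

  A₃A₁≡A₄ : ∀ x y → (A₃ · A₁) x y ≡ A₄ x y
  A₃A₁≡A₄ = eigen-injective char0 (eigen-mul (eigen-A (# 3)) (eigen-A (# 1))) (eigen-A (# 4))
    (by-rows (*-identityʳ K) (x*-1≈-x s) (-x*-1≈x s) (*-identityʳ (- K)) (*-identityʳ (- t)) (*-identityʳ t))

  A₄A₁≡A₃ : ∀ x y → (A₄ · A₁) x y ≡ A₃ x y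
  A₄A₁≡A₃ = eigen-injective char0 (eigen-mul (eigen-A (# 4)) (eigen-A (# 1))) (eigen-A (# 3))
    (by-rows (*-identityʳ K) (-x*-1≈x s) (x*-1≈-x s) (*-identityʳ (- K)) (*-identityʳ (- t)) (*-identityʳ t))

  Same²≡2v·Same : ∀ x y → (Same · Same) x y ≡ (2 ℕ.* v) ℕ.* Same x y
  Same²≡2v·Same = eigen-injective char0 (eigen-mul eigen-Same eigen-Same) (eigen-scale (2 ℕ.* v) eigen-Same)
    (by-rows (root (inj₂ 2+ι[2[v∸1]]≈ι[2v])) (root (inj₁ 1-1+0≈0)) (root (inj₁ 1-1+0≈0))
             (root (inj₂ 2+ι[2[v∸1]]≈ι[2v])) (root (inj₁ 1+1-2≈0)) (root (inj₁ 1+1-2≈0)))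
    where
    eigen-Same : HasEigenvalues Same (λ l → (P l (# 0) + P l (# 1)) + P l (# 2))
    eigen-Same = eigen-+ (eigen-+ (eigen-A (# 0)) (eigen-A (# 1))) (eigen-A (# 2))
    root : ∀ {σ} → σ ≈ 0# ⊎ σ ≈ ι (2 ℕ.* v) → σ * σ ≈ ι (2 ℕ.* v) * σ
    root (inj₁ σ≈0)  = trans (*-congˡ σ≈0) (trans (zeroʳ _) (sym (trans (*-congˡ σ≈0) (zeroʳ _))))
    root (inj₂ σ≈2v) = *-congʳ σ≈2v
    2+ι[2[v∸1]]≈ι[2v] : (1# + 1#) + ι (2 ℕ.* (v ℕ.∸ 1)) ≈ ι (2 ℕ.* v)
    2+ι[2[v∸1]]≈ι[2v] = trans (+-congʳ (+-congˡ (sym (+-identityʳ 1#)))) (sym ι[2v]≈2+ι[2[v∸1]])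
    1-1+0≈0 : (1# - 1#) + 0# ≈ 0#
    1-1+0≈0 = trans (+-identityʳ _) (-‿inverseʳ 1#)
    1+1-2≈0 : (1# + 1#) - ι 2 ≈ 0#
    1+1-2≈0 = solve 0 ((con (+ 1) :+ con (+ 1)) :- con (+ 2) := con (+ 0)) refl

  -- Row by row, both sides are polynomials in s, t and images of naturals that agree modulo s² = k,
  -- (v − 1)t² = (v − k)k and the linear relations between k, k − 1, v − 1 and v − k.
  difference² : ∀ x y → ((A₃ · A₃) x y ℕ.+ (A₄ · A₄) x y) ℕ.+ k ℕ.* (2 ℕ.* A₁ x y)
                      ≡ ((A₃ · A₄) x y ℕ.+ (A₄ · A₃) x y) ℕ.+ k ℕ.* (2 ℕ.* A₀ x y)
  difference² = eigen-injective char0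
    (eigen-+ (eigen-+ (eigen-mul (eigen-A (# 3)) (eigen-A (# 3))) (eigen-mul (eigen-A (# 4)) (eigen-A (# 4))))
             (eigen-scale k (eigen-scale 2 (eigen-A (# 1)))))
    (eigen-+ (eigen-+ (eigen-mul (eigen-A (# 3)) (eigen-A (# 4))) (eigen-mul (eigen-A (# 4)) (eigen-A (# 3))))
             (eigen-scale k (eigen-scale 2 (eigen-A (# 0)))))
    (by-rows refl
      (≈-modulo (ι 4) (solve 2 (λ x q → (x :* x :+ :- x :* :- x) :+ q :* (con (+ 2) :* :- con (+ 1)) :=
         ((x :* :- x :+ :- x :* x) :+ q :* (con (+ 2) :* con (+ 1))) :+ con (+ 4) :* (x :* x :- q)) refl s K) s²)
      (≈-modulo (ι 4) (solve 2 (λ x q → (:- x :* :- x :+ x :* x) :+ q :* (con (+ 2) :* :- con (+ 1)) :=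
         ((:- x :* x :+ x :* :- x) :+ q :* (con (+ 2) :* con (+ 1))) :+ con (+ 4) :* (x :* x :- q)) refl s K) s²)
      refl refl refl)

  sum² : ∀ x y → (v ℕ.∸ 1) ℕ.* ((((A₃ · A₃) x y ℕ.+ (A₃ · A₄) x y) ℕ.+ (A₄ · A₃) x y) ℕ.+ (A₄ · A₄) x y)
               ≡ k ℕ.* (2 ℕ.* ((v ℕ.∸ 1) ℕ.* (A₀ x y ℕ.+ A₁ x y))) ℕ.+ k ℕ.* (2 ℕ.* ((k ℕ.∸ 1) ℕ.* A₂ x y))
  sum² = eigen-injective char0
    (eigen-scale (v ℕ.∸ 1) (eigen-+ (eigen-+ (eigen-+ (eigen-mul (eigen-A (# 3)) (eigen-A (# 3)))
                                                      (eigen-mul (eigen-A (# 3)) (eigen-A (# 4))))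
                                             (eigen-mul (eigen-A (# 4)) (eigen-A (# 3))))
                                    (eigen-mul (eigen-A (# 4)) (eigen-A (# 4)))))
    (eigen-+ (eigen-scale k (eigen-scale 2 (eigen-scale (v ℕ.∸ 1) (eigen-+ (eigen-A (# 0)) (eigen-A (# 1))))))
             (eigen-scale k (eigen-scale 2 (eigen-scale (k ℕ.∸ 1) (eigen-A (# 2))))))
    (by-rows
      (≈-modulo₂ (- (ι 2 * K * K₁)) (ι 4 * K * V₁)
        (solve 4 (λ q u w x → u :* (((q :* q :+ q :* q) :+ q :* q) :+ q :* q) :=
           (q :* (con (+ 2) :* (u :* (con (+ 1) :+ con (+ 1)))) :+ q :* (con (+ 2) :* (w :* x)))
           :+ (:- (con (+ 2) :* q :* w) :* (x :- con (+ 2) :* u) :+ con (+ 4) :* q :* u :* (q :- (con (+ 1) :+ w))))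
         refl K V₁ K₁ (ι (2 ℕ.* (v ℕ.∸ 1))))
        ι[2[v∸1]]≈2V₁ K≈1+K₁)
      (solve 4 (λ x u q w → u :* (((x :* x :+ x :* :- x) :+ :- x :* x) :+ :- x :* :- x) :=
         q :* (con (+ 2) :* (u :* (con (+ 1) :+ :- con (+ 1)))) :+ q :* (con (+ 2) :* (w :* con (+ 0)))) refl s V₁ K K₁)
      (solve 4 (λ x u q w → u :* (((:- x :* :- x :+ :- x :* x) :+ x :* :- x) :+ x :* x) :=
         q :* (con (+ 2) :* (u :* (con (+ 1) :+ :- con (+ 1)))) :+ q :* (con (+ 2) :* (w :* con (+ 0)))) refl s V₁ K K₁)
      (≈-modulo₂ (- (ι 2 * K * K₁)) (ι 4 * K * V₁)
        (solve 4 (λ q u w x → u :* (((:- q :* :- q :+ :- q :* :- q) :+ :- q :* :- q) :+ :- q :* :- q) :=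
           (q :* (con (+ 2) :* (u :* (con (+ 1) :+ con (+ 1)))) :+ q :* (con (+ 2) :* (w :* x)))
           :+ (:- (con (+ 2) :* q :* w) :* (x :- con (+ 2) :* u) :+ con (+ 4) :* q :* u :* (q :- (con (+ 1) :+ w))))
         refl K V₁ K₁ (ι (2 ℕ.* (v ℕ.∸ 1))))
        ι[2[v∸1]]≈2V₁ K≈1+K₁)
      (≈-modulo₂ (ι 4) (- (ι 4 * K))
        (solve 5 (λ x u q w z → u :* (((:- x :* :- x :+ :- x :* :- x) :+ :- x :* :- x) :+ :- x :* :- x) :=
           (q :* (con (+ 2) :* (u :* (con (+ 1) :+ con (+ 1)))) :+ q :* (con (+ 2) :* (w :* :- con (+ 2))))
           :+ (con (+ 4) :* (u :* (x :* x) :- z :* q) :+ :- (con (+ 4) :* q) :* (u :- (z :+ w)))) refl t V₁ K K₁ Vₖ)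
        V₁t²≈VₖK V₁≈Vₖ+K₁)
      (≈-modulo₂ (ι 4) (- (ι 4 * K))
        (solve 5 (λ x u q w z → u :* (((x :* x :+ x :* x) :+ x :* x) :+ x :* x) :=
           (q :* (con (+ 2) :* (u :* (con (+ 1) :+ con (+ 1)))) :+ q :* (con (+ 2) :* (w :* :- con (+ 2))))
           :+ (con (+ 4) :* (u :* (x :* x) :- z :* q) :+ :- (con (+ 4) :* q) :* (u :- (z :+ w)))) refl t V₁ K K₁ Vₖ)
        V₁t²≈VₖK V₁≈Vₖ+K₁))

  rowSum₃ : ∀ i j l x → sumℕ N (λ z → (A i x z ℕ.+ A j x z) ℕ.+ A l x z) ≡ (valency i ℕ.+ valency j) ℕ.+ valency l
  rowSum₃ i j l x = ≡.trans (ℕΣ.∑-distrib-+ N _ (A l x))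
    (≡.cong₂ ℕ._+_ (≡.trans (ℕΣ.∑-distrib-+ N (A i x) (A j x)) (≡.cong₂ ℕ._+_ (A-rowSum i x) (A-rowSum j x))) (A-rowSum l x))

  relations : WeighingRelations v k
  relations = record
    { A₁-rowSum     = A-rowSum (# 1)
    ; Same-rowSum   = λ x → ≡.trans (rowSum₃ (# 0) (# 1) (# 2) x) (≡.sym 2v≡2+2[v∸1])
    ; Other-rowSum  = λ x → ≡.trans (rowSum₃ (# 3) (# 4) (# 5) x) k+k+2[v∸k]≡2v
    ; A₃A₁≡A₄       = A₃A₁≡A₄
    ; A₄A₁≡A₃       = A₄A₁≡A₃
    ; Same²≡2v·Same = Same²≡2v·Same
    ; difference²   = difference²
    ; sum²          = sum²
    }
    where
    k+k+2[v∸k]≡2v : (k ℕ.+ k) ℕ.+ 2 ℕ.* (v ℕ.∸ k) ≡ 2 ℕ.* v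
    k+k+2[v∸k]≡2v = ≡.trans (rearrange k (v ℕ.∸ k)) (≡.cong (2 ℕ.*_) (ℕₚ.m∸n+n≡m (ℕₚ.<⇒≤ k<v)))
      where
      rearrange : ∀ k m → (k ℕ.+ k) ℕ.+ 2 ℕ.* m ≡ 2 ℕ.* (m ℕ.+ k)
      rearrange = NatSolver.solve-∀

-- Opened only here: above this point _+_, _*_ and _-_ are the field operations.
open import Data.Nat using (_+_; _*_; _∸_; _≤_; _<_; z≤n; s≤s)
open import Data.Product using (Σ; ∃; _×_; _,_; proj₁; proj₂)
open import Data.Bool using (Bool; true; false; _∧_; not)
open import Data.Fin as Fin using (toℕ)
import Data.Fin.Properties as Finₚ
import Data.Fin.Permutation as Perm
open import Relation.Nullary.Decidable using (dec-true; dec-false)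
open import Data.Integer using (_-_)

[_] : Bool → ℕ
[ b ] = if b then 1 else 0

∧≡true : ∀ {a b} → a ∧ b ≡ true → a ≡ true × b ≡ true
∧≡true {true} {true} _ = ≡.refl , ≡.refl

[∧]* : ∀ a b n → [ a ∧ b ] * n ≡ [ a ] * ([ b ] * n)
[∧]* true  b n = ≡.sym (ℕₚ.+-identityʳ ([ b ] * n))
[∧]* false b n = ≡.refl

term≤∑ : ∀ n (f : Fin n → ℕ) i → f i ≤ sumℕ n f
term≤∑ (suc n) f zero    = ℕₚ.m≤m+n (f zero) _
term≤∑ (suc n) f (suc i) = ℕₚ.≤-trans (term≤∑ n (f ∘ suc) i) (ℕₚ.m≤n+m _ (f zero))

∑≡0⇒≡0 : ∀ n (f : Fin n → ℕ) → sumℕ n f ≡ 0 → ∀ i → f i ≡ 0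
∑≡0⇒≡0 n f ∑f≡0 i = ℕₚ.n≤0⇒n≡0 (ℕₚ.≤-trans (term≤∑ n f i) (ℕₚ.≤-reflexive ∑f≡0))

∑≡1⇒indicator : ∀ n (f : Fin n → ℕ) → sumℕ n f ≡ 1 → Σ (Fin n) λ c → f c ≡ 1 × (∀ i → i ≢ c → f i ≡ 0)
∑≡1⇒indicator (suc n) f ∑f≡1 with f zero in f₀
... | zero  = let (c , fc≡1 , off) = ∑≡1⇒indicator n (f ∘ suc) ∑f≡1 in
  suc c , fc≡1 , λ { zero _ → f₀ ; (suc i) i≢c → off i (i≢c ∘ ≡.cong suc) }
... | suc zero = zero , f₀ , λ { zero 0≢0 → ⊥-elim (0≢0 ≡.refl)
                               ; (suc i) _ → ∑≡0⇒≡0 n (f ∘ suc) (ℕₚ.suc-injective ∑f≡1) i }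

∑-subst : ∀ {m n} (e : m ≡ n) (f : Fin n → ℕ) → sumℕ m (f ∘ ≡.subst Fin e) ≡ sumℕ n f
∑-subst ≡.refl f = ≡.refl

subst-injective : ∀ {m n} (e : m ≡ n) {i j : Fin m} → ≡.subst Fin e i ≡ ≡.subst Fin e j → i ≡ j
subst-injective ≡.refl i≡j = i≡j

count : ∀ n → (Fin n → Bool) → ℕ
count n b = sumℕ n (λ z → [ b z ])

enum : ∀ n (b : Fin n → Bool) → Fin (count n b) → Fin n
enum (suc n) b i with b zero
enum (suc n) b zero    | true  = zero
enum (suc n) b (suc i) | true  = suc (enum n (b ∘ suc) i)
enum (suc n) b i       | false = suc (enum n (b ∘ suc) i)

enum-true : ∀ n (b : Fin n → Bool) i → b (enum n b i) ≡ true
enum-true (suc n) b i with b zero in b₀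
enum-true (suc n) b zero    | true  = b₀
enum-true (suc n) b (suc i) | true  = enum-true n (b ∘ suc) i
enum-true (suc n) b i       | false = enum-true n (b ∘ suc) i

enum-injective : ∀ n (b : Fin n → Bool) {i j} → enum n b i ≡ enum n b j → i ≡ j
enum-injective (suc n) b {i} {j} eq with b zero
enum-injective (suc n) b {zero}  {zero}  eq | true = ≡.refl
enum-injective (suc n) b {suc i} {suc j} eq | true = ≡.cong suc (enum-injective n (b ∘ suc) (suc-injective eq))
enum-injective (suc n) b {i}     {j}     eq | false = enum-injective n (b ∘ suc) (suc-injective eq)

∑-enum : ∀ n (b : Fin n → Bool) (g : Fin n → ℕ) → sumℕ (count n b) (g ∘ enum n b) ≡ sumℕ n (λ z → [ b z ] * g z)
∑-enum zero    b g = ≡.refl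
∑-enum (suc n) b g with b zero
... | true  = ≡.cong₂ _+_ (≡.sym (ℕₚ.+-identityʳ (g zero))) (∑-enum n (b ∘ suc) (g ∘ suc))
... | false = ∑-enum n (b ∘ suc) (g ∘ suc)

module PerfectMatching {N : ℕ} (M : Fin N → Fin N → ℕ) (M-symmetric : ∀ x y → M x y ≡ M y x)
                       (M-rowSum : ∀ x → sumℕ N (M x) ≡ 1) where

  partner : Fin N → Fin N
  partner x = proj₁ (∑≡1⇒indicator N (M x) (M-rowSum x))

  M-partner : ∀ x → M x (partner x) ≡ 1
  M-partner x = proj₁ (proj₂ (∑≡1⇒indicator N (M x) (M-rowSum x)))

  M-nonpartner : ∀ x z → z ≢ partner x → M x z ≡ 0
  M-nonpartner x = proj₂ (proj₂ (∑≡1⇒indicator N (M x) (M-rowSum x)))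

  M≡1⇒partner : ∀ {x z} → M x z ≡ 1 → z ≡ partner x
  M≡1⇒partner {x} {z} Mxz≡1 with z ≟ partner x
  ... | yes z≡px = z≡px
  ... | no  z≢px = ⊥-elim (ℕₚ.0≢1+n (≡.trans (≡.sym (M-nonpartner x z z≢px)) Mxz≡1))

  partner-involutive : ∀ x → partner (partner x) ≡ x
  partner-involutive x = ≡.sym (M≡1⇒partner (≡.trans (M-symmetric (partner x) x) (M-partner x)))

  ∑-*M : ∀ (g : Fin N → ℕ) z → sumℕ N (λ w → g w * M w z) ≡ g (partner z)
  ∑-*M g z = ≡.trans (ℕΣ.∑-select N _ (partner z) off) (≡.trans (≡.cong (g (partner z) *_) M-pz-z) (ℕₚ.*-identityʳ _))
    where
    M-pz-z : M (partner z) z ≡ 1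
    M-pz-z = ≡.trans (M-symmetric (partner z) z) (M-partner z)
    off : ∀ w → w ≢ partner z → g w * M w z ≡ 0
    off w w≢pz = ≡.trans (≡.cong (g w *_) (≡.trans (M-symmetric w z) (M-nonpartner z w w≢pz))) (ℕₚ.*-zeroʳ (g w))

module FixedPointFreeInvolution {N : ℕ} (p : Fin N → Fin N) (p-involutive : ∀ x → p (p x) ≡ x)
                                (p-fixedPointFree : ∀ x → p x ≢ x) where

  first : Fin N → Bool
  first x = does (x Finₚ.<? p x)

  [first]+[first-p]≡1 : ∀ x → [ first x ] + [ first (p x) ] ≡ 1
  [first]+[first-p]≡1 x with Finₚ.<-cmp x (p x)
  ... | tri< x<px _ _ rewrite dec-true (x Finₚ.<? p x) x<px
                            | dec-false (p x Finₚ.<? p (p x)) (λ px<ppx → Finₚ.<-asym x<px (≡.subst (p x Fin.<_) (p-involutive x) px<ppx)) = ≡.refl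
  ... | tri≈ _ x≡px _ = ⊥-elim (p-fixedPointFree x (≡.sym x≡px))
  ... | tri> _ _ px<x rewrite dec-false (x Finₚ.<? p x) (Finₚ.<-asym px<x)
                            | dec-true (p x Finₚ.<? p (p x)) (≡.subst (p x Fin.<_) (≡.sym (p-involutive x)) px<x) = ≡.refl

  ¬first∧first-p : ∀ x → first x ≡ true → first (p x) ≡ true → ⊥
  ¬first∧first-p x first-x first-px with () ← ≡.subst₂ (λ a b → [ a ] + [ b ] ≡ 1) first-x first-px ([first]+[first-p]≡1 x)

  ∑-∘p : ∀ (f : Fin N → ℕ) → sumℕ N (f ∘ p) ≡ sumℕ N f
  ∑-∘p f = ≡.sym (ℕΣ.∑-permute N f (Perm.permutation p p p-involutive p-involutive))

  ∑-halve : ∀ (f : Fin N → ℕ) → (∀ z → f (p z) ≡ f z) → sumℕ N f ≡ 2 * sumℕ N (λ z → [ first z ] * f z)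
  ∑-halve f f∘p≡f = begin
    sumℕ N f                                                        ≡⟨ ℕΣ.∑-cong N split ⟩
    sumℕ N (λ z → [ first z ] * f z + [ first (p z) ] * f (p z))    ≡⟨ ℕΣ.∑-distrib-+ N _ _ ⟩
    S + sumℕ N (λ z → [ first (p z) ] * f (p z))                    ≡⟨ ≡.cong (_+_ S) (∑-∘p (λ z → [ first z ] * f z)) ⟩
    S + S                                                           ≡⟨ ≡.cong (_+_ S) (≡.sym (ℕₚ.+-identityʳ S)) ⟩
    2 * S                                                           ∎
    where
    open ≡.≡-Reasoning
    S : ℕ
    S = sumℕ N (λ z → [ first z ] * f z)
    split : ∀ z → f z ≡ [ first z ] * f z + [ first (p z) ] * f (p z)
    split z = begin
      f z                                              ≡⟨ ≡.sym (ℕₚ.*-identityˡ (f z)) ⟩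
      1 * f z                                          ≡⟨ ≡.cong (_* f z) (≡.sym ([first]+[first-p]≡1 z)) ⟩
      ([ first z ] + [ first (p z) ]) * f z            ≡⟨ ℕₚ.*-distribʳ-+ (f z) [ first z ] _ ⟩
      [ first z ] * f z + [ first (p z) ] * f z        ≡⟨ ≡.cong (λ y → [ first z ] * f z + [ first (p z) ] * y) (≡.sym (f∘p≡f z)) ⟩
      [ first z ] * f z + [ first (p z) ] * f (p z)    ∎

  ∑-first : ∀ (b : Fin N → Bool) (g : Fin N → ℕ) → (∀ z → b (p z) ≡ b z) → (∀ z → g (p z) ≡ g z) →
            sumℕ N (λ z → [ b z ] * g z) ≡ 2 * sumℕ N (λ z → [ first z ∧ b z ] * g z)
  ∑-first b g b∘p≡b g∘p≡g =
    ≡.trans (∑-halve (λ z → [ b z ] * g z) (λ z → ≡.cong₂ (λ c n → [ c ] * n) (b∘p≡b z) (g∘p≡g z)))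
            (≡.cong (2 *_) (ℕΣ.∑-cong N (λ z → ≡.sym ([∧]* (first z) (b z) (g z)))))

  count-first : ∀ (b : Fin N → Bool) → (∀ z → b (p z) ≡ b z) → count N b ≡ 2 * count N (λ z → first z ∧ b z)
  count-first b b∘p≡b = begin
    count N b                                        ≡⟨ ℕΣ.∑-cong N (λ z → ≡.sym (ℕₚ.*-identityʳ [ b z ])) ⟩
    sumℕ N (λ z → [ b z ] * 1)                       ≡⟨ ∑-first b (λ _ → 1) b∘p≡b (λ _ → ≡.refl) ⟩
    2 * sumℕ N (λ z → [ first z ∧ b z ] * 1)         ≡⟨ ≡.cong (2 *_) (ℕΣ.∑-cong N (λ z → ℕₚ.*-identityʳ [ first z ∧ b z ])) ⟩
    2 * count N (λ z → first z ∧ b z)                ∎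
    where open ≡.≡-Reasoning

square-closed⇒transitive : ∀ {N} (B : Fin N → Fin N → ℕ) c → (∀ x y → B x y ≤ 1) →
                           (∀ x z → matMulℕ B B x z ≡ c * B x z) →
                           ∀ {x y z} → B x y ≡ 1 → B y z ≡ 1 → B x z ≡ 1
square-closed⇒transitive {N} B c B≤1 B²≡cB {x} {y} {z} Bxy≡1 Byz≡1 with B x z in Bxz | B≤1 x z
... | zero  | _ = ⊥-elim (ℕₚ.<-irrefl ≡.refl (begin-strict
      0                       <⟨ s≤s z≤n ⟩
      1 * 1                   ≡⟨ ≡.sym (≡.cong₂ _*_ Bxy≡1 Byz≡1) ⟩
      B x y * B y z           ≤⟨ term≤∑ N (λ w → B x w * B w z) y ⟩
      matMulℕ B B x z         ≡⟨ B²≡cB x z ⟩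
      c * B x z               ≡⟨ ≡.cong (c *_) Bxz ⟩
      c * 0                   ≡⟨ ℕₚ.*-zeroʳ c ⟩
      0                       ∎))
  where open ℕₚ.≤-Reasoning
... | suc zero | _ = ≡.refl
... | suc (suc _) | s≤s ()

≤1⇒[≡ᵇ1] : ∀ {n} → n ≤ 1 → [ n ℕ.≡ᵇ 1 ] ≡ n
≤1⇒[≡ᵇ1] z≤n       = ≡.refl
≤1⇒[≡ᵇ1] (s≤s z≤n) = ≡.refl

≤1⇒0⊎1 : ∀ {n} → n ≤ 1 → n ≡ 0 ⊎ n ≡ 1
≤1⇒0⊎1 z≤n       = inj₁ ≡.refl
≤1⇒0⊎1 (s≤s z≤n) = inj₂ ≡.refl

[b]+[not-b]≡1 : ∀ b → [ b ] + [ not b ] ≡ 1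
[b]+[not-b]≡1 true  = ≡.refl
[b]+[not-b]≡1 false = ≡.refl

δ-refl : ∀ {n} (x : Fin n) → δ x x ≡ 1
δ-refl x rewrite dec-true (x ≟ x) ≡.refl = ≡.refl

δ-≢ : ∀ {n} {x y : Fin n} → x ≢ y → δ x y ≡ 0
δ-≢ {x = x} {y} x≢y rewrite dec-false (x ≟ y) x≢y = ≡.refl

δ-injective : ∀ {m n} (f : Fin m → Fin n) → (∀ {i j} → f i ≡ f j → i ≡ j) → ∀ i j → δ (f i) (f j) ≡ δ i j
δ-injective f f-injective i j with i ≟ j
... | yes ≡.refl = δ-refl (f i)
... | no  i≢j    = δ-≢ (i≢j ∘ f-injective)

bitDifference : ∀ a b → a + b ≤ 1 → + a - + b ≡ + 0 ⊎ + a - + b ≡ + 1 ⊎ + a - + b ≡ ℤ.- (+ 1)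
bitDifference zero       zero       _         = inj₁ ≡.refl
bitDifference (suc zero) zero       _         = inj₂ (inj₁ ≡.refl)
bitDifference zero       (suc zero) _         = inj₂ (inj₂ ≡.refl)
bitDifference (suc zero) (suc _)    (s≤s ())
bitDifference zero       (suc (suc _)) (s≤s ())
bitDifference (suc (suc _)) _       (s≤s ())

∣bitDifference∣ : ∀ a b → a + b ≤ 1 → ∣ + a - + b ∣ ≡ a + b
∣bitDifference∣ zero       zero       _         = ≡.refl
∣bitDifference∣ (suc zero) zero       _         = ≡.refl
∣bitDifference∣ zero       (suc zero) _         = ≡.refl
∣bitDifference∣ (suc zero) (suc _)    (s≤s ())
∣bitDifference∣ zero       (suc (suc _)) (s≤s ())
∣bitDifference∣ (suc (suc _)) _       (s≤s ())

[a-b][c-d] : ∀ a b c d → (+ a - + b) ℤ.* (+ c - + d) ≡ + (a * c + b * d) - + (a * d + b * c)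
[a-b][c-d] a b c d = begin
  (+ a - + b) ℤ.* (+ c - + d)                                  ≡⟨ ring (+ a) (+ b) (+ c) (+ d) ⟩
  (+ a ℤ.* + c ℤ.+ + b ℤ.* + d) - (+ a ℤ.* + d ℤ.+ + b ℤ.* + c) ≡⟨ ≡.cong₂ _-_ (+-homo a c b d) (+-homo a d b c) ⟩
  + (a * c + b * d) - + (a * d + b * c)                        ∎
  where
  open ≡.≡-Reasoning
  ring : ∀ a b c d → (a - b) ℤ.* (c - d) ≡ (a ℤ.* c ℤ.+ b ℤ.* d) - (a ℤ.* d ℤ.+ b ℤ.* c)
  ring = IntSolver.solve-∀
  +-homo : ∀ a c b d → + a ℤ.* + c ℤ.+ + b ℤ.* + d ≡ + (a * c + b * d)
  +-homo a c b d = ≡.sym (≡.trans (ℤₚ.pos-+ (a * c) (b * d)) (≡.cong₂ ℤ._+_ (ℤₚ.pos-* a c) (ℤₚ.pos-* b d)))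

∑ℤ-difference : ∀ n (f g : Fin n → ℕ) → sumℤ n (λ j → + f j - + g j) ≡ + sumℕ n f - + sumℕ n g
∑ℤ-difference zero    f g = ≡.refl
∑ℤ-difference (suc n) f g = begin
  (+ f zero - + g zero) ℤ.+ sumℤ n (λ j → + f (suc j) - + g (suc j))
    ≡⟨ ≡.cong (ℤ._+_ (+ f zero - + g zero)) (∑ℤ-difference n (f ∘ suc) (g ∘ suc)) ⟩
  (+ f zero - + g zero) ℤ.+ (+ sumℕ n (f ∘ suc) - + sumℕ n (g ∘ suc))
    ≡⟨ ring (+ f zero) (+ g zero) (+ sumℕ n (f ∘ suc)) (+ sumℕ n (g ∘ suc)) ⟩
  (+ f zero ℤ.+ + sumℕ n (f ∘ suc)) - (+ g zero ℤ.+ + sumℕ n (g ∘ suc))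
    ≡⟨ ≡.sym (≡.cong₂ _-_ (ℤₚ.pos-+ (f zero) _) (ℤₚ.pos-+ (g zero) _)) ⟩
  + sumℕ (suc n) f - + sumℕ (suc n) g
    ∎
  where
  open ≡.≡-Reasoning
  ring : ∀ a b c d → (a - b) ℤ.+ (c - d) ≡ (a ℤ.+ c) - (b ℤ.+ d)
  ring = IntSolver.solve-∀

cong₄ : ∀ {A B : Set} (f : A → A → A → A → B) {a a' b b' c c' d d'} →
        a ≡ a' → b ≡ b' → c ≡ c' → d ≡ d' → f a b c d ≡ f a' b' c' d'
cong₄ f ≡.refl ≡.refl ≡.refl ≡.refl = ≡.refl

module Construction (v k : ℕ) (0<k : 0 < k) (k<v : k < v) {N : ℕ} {A : Fin 6 → Fin N → Fin N → ℕ}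
                    (scheme : IsSymAssocScheme 5 N A) (relations : Scheme.WeighingRelations A v k) where
  open IsSymAssocScheme scheme
  open Scheme A
  open WeighingRelations relations

  Same+Other≡1 : ∀ x y → Same x y + Other x y ≡ 1
  Same+Other≡1 x y = ≡.trans (rearrange (A₀ x y) (A₁ x y) (A₂ x y) (A₃ x y) (A₄ x y) (A₅ x y)) (sum≡J x y)
    where
    rearrange : ∀ a b c d e f → ((a + b) + c) + ((d + e) + f) ≡ a + (b + (c + (d + (e + (f + 0)))))
    rearrange = NatSolver.solve-∀

  Same≤1 : ∀ x y → Same x y ≤ 1
  Same≤1 x y = ℕₚ.≤-trans (ℕₚ.m≤m+n (Same x y) (Other x y)) (ℕₚ.≤-reflexive (Same+Other≡1 x y))

  A₃+A₄≤1 : ∀ x y → A₃ x y + A₄ x y ≤ 1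
  A₃+A₄≤1 x y = ℕₚ.≤-trans (ℕₚ.m≤m+n _ (A₅ x y))
                  (ℕₚ.≤-trans (ℕₚ.m≤n+m (Other x y) (Same x y)) (ℕₚ.≤-reflexive (Same+Other≡1 x y)))

  Same≡1⇒A₃≡0×A₄≡0 : ∀ {x y} → Same x y ≡ 1 → A₃ x y ≡ 0 × A₄ x y ≡ 0
  Same≡1⇒A₃≡0×A₄≡0 {x} {y} Sxy≡1 = ℕₚ.m+n≡0⇒m≡0 _ A₃+A₄≡0 , ℕₚ.m+n≡0⇒n≡0 (A₃ x y) A₃+A₄≡0
    where
    Other≡0 : Other x y ≡ 0
    Other≡0 = ℕₚ.+-cancelˡ-≡ 1 _ 0 (≡.trans (≡.cong (_+ Other x y) (≡.sym Sxy≡1)) (Same+Other≡1 x y))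
    A₃+A₄≡0 : A₃ x y + A₄ x y ≡ 0
    A₃+A₄≡0 = ℕₚ.m+n≡0⇒m≡0 _ Other≡0

  Same-refl : ∀ x → Same x x ≡ 1
  Same-refl x = ℕₚ.≤-antisym (Same≤1 x x)
    (ℕₚ.≤-trans (ℕₚ.≤-reflexive (≡.sym (≡.trans (A₀≡I x x) (δ-refl x)))) (ℕₚ.≤-trans (ℕₚ.m≤m+n _ _) (ℕₚ.m≤m+n _ _)))

  Same-sym : ∀ x y → Same x y ≡ Same y x
  Same-sym x y = ≡.cong₂ _+_ (≡.cong₂ _+_ (symmetric (# 0) x y) (symmetric (# 1) x y)) (symmetric (# 2) x y)

  Same-trans : ∀ {x y z} → Same x y ≡ 1 → Same y z ≡ 1 → Same x z ≡ 1
  Same-trans = square-closed⇒transitive Same (2 * v) Same≤1 Same²≡2v·Same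

  A₁≡1⇒Same≡1 : ∀ {x y} → A₁ x y ≡ 1 → Same x y ≡ 1
  A₁≡1⇒Same≡1 {x} {y} A₁xy≡1 = ℕₚ.≤-antisym (Same≤1 x y)
    (ℕₚ.≤-trans (ℕₚ.≤-reflexive (≡.sym A₁xy≡1)) (ℕₚ.≤-trans (ℕₚ.m≤n+m _ (A₀ x y)) (ℕₚ.m≤m+n _ _)))

  A₁-diagonal : ∀ x → A₁ x x ≡ 0
  A₁-diagonal x = ℕₚ.m+n≡0⇒m≡0 _
    (ℕₚ.suc-injective (≡.trans (≡.cong (λ a → (a + A₁ x x) + A₂ x x) (≡.sym A₀xx≡1)) (Same-refl x)))
    where
    A₀xx≡1 : A₀ x x ≡ 1
    A₀xx≡1 = ≡.trans (A₀≡I x x) (δ-refl x)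

  open PerfectMatching A₁ (symmetric (# 1)) A₁-rowSum

  partner-fixedPointFree : ∀ x → partner x ≢ x
  partner-fixedPointFree x px≡x = ℕₚ.0≢1+n (≡.trans (≡.sym (A₁-diagonal x)) (≡.subst (λ z → A₁ x z ≡ 1) px≡x (M-partner x)))

  open FixedPointFreeInvolution partner partner-involutive partner-fixedPointFree

  A₃∘partner : ∀ x z → A₃ x (partner z) ≡ A₄ x z
  A₃∘partner x z = ≡.trans (≡.sym (∑-*M (A₃ x) z)) (A₃A₁≡A₄ x z)

  A₄∘partner : ∀ x z → A₄ x (partner z) ≡ A₃ x z
  A₄∘partner x z = ≡.trans (≡.sym (∑-*M (A₄ x) z)) (A₄A₁≡A₃ x z)

  Same≡1⇒Same-partner : ∀ {x z} → Same x z ≡ 1 → Same x (partner z) ≡ 1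
  Same≡1⇒Same-partner {x} {z} Sxz≡1 = Same-trans Sxz≡1 (A₁≡1⇒Same≡1 (M-partner z))

  Same∘partner : ∀ x z → Same x (partner z) ≡ Same x z
  Same∘partner x z with ≤1⇒0⊎1 (Same≤1 x z) | ≤1⇒0⊎1 (Same≤1 x (partner z))
  ... | inj₂ Sxz≡1 | _           = ≡.trans (Same≡1⇒Same-partner Sxz≡1) (≡.sym Sxz≡1)
  ... | inj₁ Sxz≡0 | inj₁ Sxpz≡0 = ≡.trans Sxpz≡0 (≡.sym Sxz≡0)
  ... | inj₁ Sxz≡0 | inj₂ Sxpz≡1 = ⊥-elim (ℕₚ.0≢1+n (≡.trans (≡.sym Sxz≡0)
          (≡.subst (λ w → Same x w ≡ 1) (partner-involutive z) (Same≡1⇒Same-partner Sxpz≡1))))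

  x₀ : Fin N
  x₀ = proj₁ (nonzero (# 0))

  inBlock : Fin N → Bool
  inBlock z = Same x₀ z ℕ.≡ᵇ 1

  [inBlock]≡Same : ∀ z → [ inBlock z ] ≡ Same x₀ z
  [inBlock]≡Same z = ≤1⇒[≡ᵇ1] (Same≤1 x₀ z)

  [¬inBlock]≡Other : ∀ z → [ not (inBlock z) ] ≡ Other x₀ z
  [¬inBlock]≡Other z = ℕₚ.+-cancelˡ-≡ (Same x₀ z) _ _
    (≡.trans (≡.cong (_+ [ not (inBlock z) ]) (≡.sym ([inBlock]≡Same z)))
             (≡.trans ([b]+[not-b]≡1 (inBlock z)) (≡.sym (Same+Other≡1 x₀ z))))

  inBlock∘partner : ∀ z → inBlock (partner z) ≡ inBlock z
  inBlock∘partner z = ≡.cong (ℕ._≡ᵇ 1) (Same∘partner x₀ z)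

  isRow isCol : Fin N → Bool
  isRow z = first z ∧ inBlock z
  isCol z = first z ∧ not (inBlock z)

  #rows≡v : count N isRow ≡ v
  #rows≡v = ℕₚ.*-cancelˡ-≡ _ _ 2 (begin
    2 * count N isRow            ≡⟨ ≡.sym (count-first inBlock inBlock∘partner) ⟩
    count N inBlock              ≡⟨ ℕΣ.∑-cong N [inBlock]≡Same ⟩
    sumℕ N (Same x₀)             ≡⟨ Same-rowSum x₀ ⟩
    2 * v                        ∎)
    where open ≡.≡-Reasoning

  #cols≡v : count N isCol ≡ v
  #cols≡v = ℕₚ.*-cancelˡ-≡ _ _ 2 (begin
    2 * count N isCol            ≡⟨ ≡.sym (count-first (not ∘ inBlock) (≡.cong not ∘ inBlock∘partner)) ⟩
    count N (not ∘ inBlock)      ≡⟨ ℕΣ.∑-cong N [¬inBlock]≡Other ⟩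
    sumℕ N (Other x₀)            ≡⟨ Other-rowSum x₀ ⟩
    2 * v                        ∎)
    where open ≡.≡-Reasoning

  opaque
    row col : Fin v → Fin N
    row = enum N isRow ∘ ≡.subst Fin (≡.sym #rows≡v)
    col = enum N isCol ∘ ≡.subst Fin (≡.sym #cols≡v)

    row-isRow : ∀ i → first (row i) ≡ true × Same x₀ (row i) ≡ 1
    row-isRow i = let (first-r , inBlock-r) = ∧≡true (enum-true N isRow (≡.subst Fin (≡.sym #rows≡v) i)) in
      first-r , ≡.trans (≡.sym ([inBlock]≡Same (row i))) (≡.cong [_] inBlock-r)

    row-injective : ∀ {i j} → row i ≡ row j → i ≡ j
    row-injective = subst-injective (≡.sym #rows≡v) ∘ enum-injective N isRow

    ∑-col : ∀ (g : Fin N → ℕ) → sumℕ v (g ∘ col) ≡ sumℕ N (λ z → [ isCol z ] * g z)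
    ∑-col g = ≡.trans (∑-subst (≡.sym #cols≡v) (g ∘ enum N isCol)) (∑-enum N isCol g)

  ∑-outsideBlock : ∀ (G : Fin N → ℕ) → (∀ w → G (partner w) ≡ G w) → (∀ w → Same x₀ w ≡ 1 → G w ≡ 0) →
                   sumℕ N G ≡ 2 * sumℕ v (G ∘ col)
  ∑-outsideBlock G G∘p≡G G-block = begin
    sumℕ N G                                    ≡⟨ ℕΣ.∑-cong N restrict ⟩
    sumℕ N (λ w → [ not (inBlock w) ] * G w)    ≡⟨ ∑-first (not ∘ inBlock) G (≡.cong not ∘ inBlock∘partner) G∘p≡G ⟩
    2 * sumℕ N (λ w → [ isCol w ] * G w)        ≡⟨ ≡.cong (2 *_) (≡.sym (∑-col G)) ⟩
    2 * sumℕ v (G ∘ col)                        ∎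
    where
    open ≡.≡-Reasoning
    restrict : ∀ w → G w ≡ [ not (inBlock w) ] * G w
    restrict w with inBlock w in inBlock-w
    ... | true  = G-block w (≡.trans (≡.sym ([inBlock]≡Same w)) (≡.cong [_] inBlock-w))
    ... | false = ≡.sym (ℕₚ.+-identityʳ (G w))

  rowEntries : (ℕ → ℕ → ℕ → ℕ → ℕ) → Fin v → Fin v → Fin N → ℕ
  rowEntries g x y w = g (A₃ (row x) w) (A₄ (row x) w) (A₃ (row y) w) (A₄ (row y) w)

  Gram : (ℕ → ℕ → ℕ → ℕ → ℕ) → Fin v → Fin v → ℕ
  Gram g x y = sumℕ v (rowEntries g x y ∘ col)

  ∑-rowEntries : ∀ g → (∀ a b c d → g b a d c ≡ g a b c d) → (∀ c d → g 0 0 c d ≡ 0) →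
                 ∀ x y → sumℕ N (rowEntries g x y) ≡ 2 * Gram g x y
  ∑-rowEntries g g-swap g-0 x y = ∑-outsideBlock (rowEntries g x y) invariant vanishes
    where
    invariant : ∀ w → rowEntries g x y (partner w) ≡ rowEntries g x y w
    invariant w = ≡.trans (cong₄ g (A₃∘partner (row x) w) (A₄∘partner (row x) w) (A₃∘partner (row y) w) (A₄∘partner (row y) w))
                          (g-swap _ _ _ _)
    vanishes : ∀ w → Same x₀ w ≡ 1 → rowEntries g x y w ≡ 0
    vanishes w x₀~w =
      ≡.trans (≡.cong₂ (λ a b → g a b (A₃ (row y) w) (A₄ (row y) w)) (proj₁ A₃≡0×A₄≡0) (proj₂ A₃≡0×A₄≡0)) (g-0 _ _)
      where
      A₃≡0×A₄≡0 : A₃ (row x) w ≡ 0 × A₄ (row x) w ≡ 0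
      A₃≡0×A₄≡0 = Same≡1⇒A₃≡0×A₄≡0 (Same-trans (≡.trans (Same-sym (row x) x₀) (proj₂ (row-isRow x))) x₀~w)

  agree oppose total : ℕ → ℕ → ℕ → ℕ → ℕ
  agree  a b c d = a * c + b * d
  oppose a b c d = a * d + b * c
  total  a b c d = (a + b) * (c + d)

  ·≡∑ : ∀ i j r r' → (A i · A j) r r' ≡ sumℕ N (λ w → A i r w * A j r' w)
  ·≡∑ i j r r' = ℕΣ.∑-cong N (λ w → ≡.cong (A i r w *_) (symmetric j w r'))

  2·Gram-agree : ∀ x y → 2 * Gram agree x y ≡ (A₃ · A₃) (row x) (row y) + (A₄ · A₄) (row x) (row y)
  2·Gram-agree x y = ≡.sym (≡.trans (≡.cong₂ _+_ (·≡∑ (# 3) (# 3) _ _) (·≡∑ (# 4) (# 4) _ _))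
    (≡.trans (≡.sym (ℕΣ.∑-distrib-+ N _ _)) (∑-rowEntries agree (λ a b c d → ℕₚ.+-comm (b * d) (a * c)) (λ _ _ → ≡.refl) x y)))

  2·Gram-oppose : ∀ x y → 2 * Gram oppose x y ≡ (A₃ · A₄) (row x) (row y) + (A₄ · A₃) (row x) (row y)
  2·Gram-oppose x y = ≡.sym (≡.trans (≡.cong₂ _+_ (·≡∑ (# 3) (# 4) _ _) (·≡∑ (# 4) (# 3) _ _))
    (≡.trans (≡.sym (ℕΣ.∑-distrib-+ N _ _)) (∑-rowEntries oppose (λ a b c d → ℕₚ.+-comm (b * c) (a * d)) (λ _ _ → ≡.refl) x y)))

  2·Gram-total : ∀ x y → 2 * Gram total x y
               ≡ (((A₃ · A₃) (row x) (row y) + (A₃ · A₄) (row x) (row y)) + (A₄ · A₃) (row x) (row y)) + (A₄ · A₄) (row x) (row y)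
  2·Gram-total x y = ≡.sym (begin
    (((A₃ · A₃) r r' + (A₃ · A₄) r r') + (A₄ · A₃) r r') + (A₄ · A₄) r r'
      ≡⟨ ≡.cong₂ _+_ (≡.cong₂ _+_ (≡.cong₂ _+_ (·≡∑ (# 3) (# 3) r r') (·≡∑ (# 3) (# 4) r r')) (·≡∑ (# 4) (# 3) r r'))
                     (·≡∑ (# 4) (# 4) r r') ⟩
    ((∑ₙ (λ w → A₃ r w * A₃ r' w) + ∑ₙ (λ w → A₃ r w * A₄ r' w)) + ∑ₙ (λ w → A₄ r w * A₃ r' w)) + ∑ₙ (λ w → A₄ r w * A₄ r' w)
      ≡⟨ ≡.sym (∑-distrib₄ (λ w → A₃ r w * A₃ r' w) (λ w → A₃ r w * A₄ r' w) (λ w → A₄ r w * A₃ r' w) (λ w → A₄ r w * A₄ r' w)) ⟩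
    ∑ₙ (λ w → ((A₃ r w * A₃ r' w + A₃ r w * A₄ r' w) + A₄ r w * A₃ r' w) + A₄ r w * A₄ r' w)
      ≡⟨ ℕΣ.∑-cong N (λ w → expand (A₃ r w) (A₄ r w) (A₃ r' w) (A₄ r' w)) ⟩
    ∑ₙ (rowEntries total x y)
      ≡⟨ ∑-rowEntries total (λ a b c d → ≡.cong₂ _*_ (ℕₚ.+-comm b a) (ℕₚ.+-comm d c)) (λ _ _ → ≡.refl) x y ⟩
    2 * Gram total x y ∎)
    where
    open ≡.≡-Reasoning
    r r' : Fin N
    r  = row x
    r' = row y
    ∑ₙ : (Fin N → ℕ) → ℕ
    ∑ₙ = sumℕ N
    expand : ∀ a b c d → ((a * c + a * d) + b * c) + b * d ≡ (a + b) * (c + d)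
    expand = NatSolver.solve-∀
    ∑-distrib₄ : ∀ (f g h i : Fin N → ℕ) → ∑ₙ (λ w → ((f w + g w) + h w) + i w) ≡ ((∑ₙ f + ∑ₙ g) + ∑ₙ h) + ∑ₙ i
    ∑-distrib₄ f g h i = ≡.trans (ℕΣ.∑-distrib-+ N _ i)
      (≡.cong (_+ ∑ₙ i) (≡.trans (ℕΣ.∑-distrib-+ N _ h) (≡.cong (_+ ∑ₙ h) (ℕΣ.∑-distrib-+ N f g))))

  A₀-rows : ∀ x y → A₀ (row x) (row y) ≡ δ x y
  A₀-rows x y = ≡.trans (A₀≡I (row x) (row y)) (δ-injective row row-injective x y)

  A₁-rows : ∀ x y → A₁ (row x) (row y) ≡ 0
  A₁-rows x y with zeroOne (# 1) (row x) (row y)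
  ... | inj₁ A₁≡0 = A₁≡0
  ... | inj₂ A₁≡1 = ⊥-elim (¬first∧first-p (row x) (proj₁ (row-isRow x))
                      (≡.subst (λ z → first z ≡ true) (M≡1⇒partner A₁≡1) (proj₁ (row-isRow y))))

  Same-rows : ∀ x y → Same (row x) (row y) ≡ 1
  Same-rows x y = Same-trans (≡.trans (Same-sym (row x) x₀) (proj₂ (row-isRow x))) (proj₂ (row-isRow y))

  Gram-agree≡Gram-oppose+kδ : ∀ x y → Gram agree x y ≡ Gram oppose x y + k * δ x y
  Gram-agree≡Gram-oppose+kδ x y = ℕₚ.*-cancelˡ-≡ _ _ 2 (begin
    2 * Gram agree x y
      ≡⟨ drop-zero (2 * Gram agree x y) k ⟩
    2 * Gram agree x y + k * (2 * 0)
      ≡⟨ ≡.cong₂ _+_ (2·Gram-agree x y) (≡.cong (λ a → k * (2 * a)) (≡.sym (A₁-rows x y))) ⟩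
    ((A₃ · A₃) r r' + (A₄ · A₄) r r') + k * (2 * A₁ r r')
      ≡⟨ difference² r r' ⟩
    ((A₃ · A₄) r r' + (A₄ · A₃) r r') + k * (2 * A₀ r r')
      ≡⟨ ≡.cong₂ _+_ (≡.sym (2·Gram-oppose x y)) (≡.cong (λ a → k * (2 * a)) (A₀-rows x y)) ⟩
    2 * Gram oppose x y + k * (2 * δ x y)
      ≡⟨ factor-2 (Gram oppose x y) k (δ x y) ⟩
    2 * (Gram oppose x y + k * δ x y)
      ∎)
    where
    open ≡.≡-Reasoning
    r r' : Fin N
    r  = row x
    r' = row y
    drop-zero : ∀ a k → a ≡ a + k * (2 * 0)
    drop-zero = NatSolver.solve-∀
    factor-2 : ∀ a k d → 2 * a + k * (2 * d) ≡ 2 * (a + k * d)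
    factor-2 = NatSolver.solve-∀

  δ+A₂-rows : ∀ x y → δ x y + A₂ (row x) (row y) ≡ 1
  δ+A₂-rows x y = ≡.subst (λ a → a + A₂ (row x) (row y) ≡ 1) (ℕₚ.+-identityʳ (δ x y))
    (≡.subst₂ (λ a b → (a + b) + A₂ (row x) (row y) ≡ 1) (A₀-rows x y) (A₁-rows x y) (Same-rows x y))

  [v∸1]·2·Gram-total : ∀ x y → (v ∸ 1) * (2 * Gram total x y)
                       ≡ k * (2 * ((v ∸ 1) * δ x y)) + k * (2 * ((k ∸ 1) * A₂ (row x) (row y)))
  [v∸1]·2·Gram-total x y =
    ≡.trans (≡.cong ((v ∸ 1) *_) (2·Gram-total x y)) (≡.trans (sum² (row x) (row y))
      (≡.cong (λ a → k * (2 * ((v ∸ 1) * a)) + k * (2 * ((k ∸ 1) * A₂ (row x) (row y))))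
              (≡.trans (≡.cong₂ _+_ (A₀-rows x y) (A₁-rows x y)) (ℕₚ.+-identityʳ (δ x y)))))

  1<v : 1 < v
  1<v = ℕₚ.≤-<-trans 0<k k<v

  instance
    v∸1-nonZero : ℕ.NonZero (v ∸ 1)
    v∸1-nonZero = ℕ.>-nonZero (ℕₚ.∸-monoˡ-< 1<v (s≤s z≤n))

  Gram-total-diagonal : ∀ x → Gram total x x ≡ k
  Gram-total-diagonal x = ℕₚ.*-cancelˡ-≡ _ _ 2 (ℕₚ.*-cancelˡ-≡ _ _ (v ∸ 1) (begin
    (v ∸ 1) * (2 * Gram total x x)                                    ≡⟨ [v∸1]·2·Gram-total x x ⟩
    k * (2 * ((v ∸ 1) * δ x x)) + k * (2 * ((k ∸ 1) * A₂ (row x) (row x)))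
      ≡⟨ ≡.cong₂ (λ d a → k * (2 * ((v ∸ 1) * d)) + k * (2 * ((k ∸ 1) * a))) (δ-refl x) A₂≡0 ⟩
    k * (2 * ((v ∸ 1) * 1)) + k * (2 * ((k ∸ 1) * 0))                 ≡⟨ rearrange (v ∸ 1) k (k ∸ 1) ⟩
    (v ∸ 1) * (2 * k)                                                 ∎))
    where
    open ≡.≡-Reasoning
    rearrange : ∀ u k m → k * (2 * (u * 1)) + k * (2 * (m * 0)) ≡ u * (2 * k)
    rearrange = NatSolver.solve-∀
    A₂≡0 : A₂ (row x) (row x) ≡ 0
    A₂≡0 = ℕₚ.suc-injective (≡.subst (λ d → d + A₂ (row x) (row x) ≡ 1) (δ-refl x) (δ+A₂-rows x x))

  Gram-total-offDiagonal : ∀ {x y} → x ≢ y → Gram total x y * (v ∸ 1) ≡ k * (k ∸ 1)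
  Gram-total-offDiagonal {x} {y} x≢y = ℕₚ.*-cancelˡ-≡ _ _ 2 (begin
    2 * (Gram total x y * (v ∸ 1))                                    ≡⟨ rearrangeˡ (Gram total x y) (v ∸ 1) ⟩
    (v ∸ 1) * (2 * Gram total x y)                                    ≡⟨ [v∸1]·2·Gram-total x y ⟩
    k * (2 * ((v ∸ 1) * δ x y)) + k * (2 * ((k ∸ 1) * A₂ (row x) (row y)))
      ≡⟨ ≡.cong₂ (λ d a → k * (2 * ((v ∸ 1) * d)) + k * (2 * ((k ∸ 1) * a))) δxy≡0 A₂≡1 ⟩
    k * (2 * ((v ∸ 1) * 0)) + k * (2 * ((k ∸ 1) * 1))                 ≡⟨ rearrangeʳ (v ∸ 1) k (k ∸ 1) ⟩
    2 * (k * (k ∸ 1))                                                 ∎)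
    where
    open ≡.≡-Reasoning
    rearrangeˡ : ∀ t u → 2 * (t * u) ≡ u * (2 * t)
    rearrangeˡ = NatSolver.solve-∀
    rearrangeʳ : ∀ u k m → k * (2 * (u * 0)) + k * (2 * (m * 1)) ≡ 2 * (k * m)
    rearrangeʳ = NatSolver.solve-∀
    δxy≡0 : δ x y ≡ 0
    δxy≡0 = δ-≢ x≢y
    A₂≡1 : A₂ (row x) (row y) ≡ 1
    A₂≡1 = ≡.subst (λ d → d + A₂ (row x) (row y) ≡ 1) δxy≡0 (δ+A₂-rows x y)

  i₀ i₁ : Fin v
  i₀ = Fin.fromℕ< (ℕₚ.<-trans (s≤s z≤n) 1<v)
  i₁ = Fin.fromℕ< 1<v

  i₀≢i₁ : i₀ ≢ i₁
  i₀≢i₁ i₀≡i₁ = ℕₚ.0≢1+n (≡.trans (≡.sym (Finₚ.toℕ-fromℕ< _)) (≡.trans (≡.cong toℕ i₀≡i₁) (Finₚ.toℕ-fromℕ< 1<v)))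

  lam : ℕ
  lam = Gram total i₀ i₁

  lam*[v∸1]≡k*[k∸1] : lam * (v ∸ 1) ≡ k * (k ∸ 1)
  lam*[v∸1]≡k*[k∸1] = Gram-total-offDiagonal i₀≢i₁

  lam≤k : lam ≤ k
  lam≤k = ℕₚ.*-cancelʳ-≤ lam k (v ∸ 1)
    (ℕₚ.≤-trans (ℕₚ.≤-reflexive lam*[v∸1]≡k*[k∸1]) (ℕₚ.*-monoʳ-≤ k (ℕₚ.∸-monoˡ-≤ 1 (ℕₚ.<⇒≤ k<v))))

  Gram-total≡ : ∀ x y → Gram total x y ≡ (k ∸ lam) * δ x y + lam
  Gram-total≡ x y with x ≟ y
  ... | yes ≡.refl = begin
    Gram total x x             ≡⟨ Gram-total-diagonal x ⟩
    k                          ≡⟨ ≡.sym (ℕₚ.m∸n+n≡m lam≤k) ⟩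
    k ∸ lam + lam              ≡⟨ ≡.cong (_+ lam) (≡.sym (ℕₚ.*-identityʳ (k ∸ lam))) ⟩
    (k ∸ lam) * 1 + lam        ∎
    where open ≡.≡-Reasoning
  ... | no  x≢y = begin
    Gram total x y             ≡⟨ ℕₚ.*-cancelʳ-≡ _ _ (v ∸ 1) (≡.trans (Gram-total-offDiagonal x≢y) (≡.sym lam*[v∸1]≡k*[k∸1])) ⟩
    lam                        ≡⟨ ≡.cong (_+ lam) (≡.sym (ℕₚ.*-zeroʳ (k ∸ lam))) ⟩
    (k ∸ lam) * 0 + lam        ∎
    where open ≡.≡-Reasoning

  W : Fin v → Fin v → ℤ
  W x j = + A₃ (row x) (col j) - + A₄ (row x) (col j)

  WWᵀ≡kI : ∀ x y → sumℤ v (λ j → W x j ℤ.* W y j) ≡ + (k * δ x y)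
  WWᵀ≡kI x y = begin
    sumℤ v (λ j → W x j ℤ.* W y j)
      ≡⟨ ℤΣ.∑-cong v (λ j → [a-b][c-d] (A₃ (row x) (col j)) (A₄ (row x) (col j)) (A₃ (row y) (col j)) (A₄ (row y) (col j))) ⟩
    sumℤ v (λ j → + rowEntries agree x y (col j) - + rowEntries oppose x y (col j))
      ≡⟨ ∑ℤ-difference v _ _ ⟩
    + Gram agree x y - + Gram oppose x y
      ≡⟨ ≡.cong (λ a → + a - + Gram oppose x y) (Gram-agree≡Gram-oppose+kδ x y) ⟩
    + (Gram oppose x y + k * δ x y) - + Gram oppose x y
      ≡⟨ ≡.cong (_- + Gram oppose x y) (ℤₚ.pos-+ (Gram oppose x y) (k * δ x y)) ⟩
    (+ Gram oppose x y ℤ.+ + (k * δ x y)) - + Gram oppose x y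
      ≡⟨ [a+b]-a≡b (+ Gram oppose x y) (+ (k * δ x y)) ⟩
    + (k * δ x y)
      ∎
    where
    open ≡.≡-Reasoning
    [a+b]-a≡b : ∀ a b → (a ℤ.+ b) - a ≡ b
    [a+b]-a≡b = IntSolver.solve-∀

  ∣W∣∣W∣ᵀ : ∀ x y → sumℕ v (λ j → ∣ W x j ∣ * ∣ W y j ∣) ≡ (k ∸ lam) * δ x y + lam
  ∣W∣∣W∣ᵀ x y = ≡.trans (ℕΣ.∑-cong v (λ j → ≡.cong₂ _*_ (∣W∣≡A₃+A₄ x j) (∣W∣≡A₃+A₄ y j))) (Gram-total≡ x y)
    where
    ∣W∣≡A₃+A₄ : ∀ x j → ∣ W x j ∣ ≡ A₃ (row x) (col j) + A₄ (row x) (col j)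
    ∣W∣≡A₃+A₄ x j = ∣bitDifference∣ (A₃ (row x) (col j)) (A₄ (row x) (col j)) (A₃+A₄≤1 (row x) (col j))

  balancedWeighing : ∃ λ (lam : ℕ) → (lam * (v ∸ 1) ≡ k * (k ∸ 1)) × ∃ λ (W : Fin v → Fin v → ℤ) → IsBalancedWeighing v k lam W
  balancedWeighing = lam , lam*[v∸1]≡k*[k∸1] , W , record
    { entries  = λ x j → bitDifference (A₃ (row x) (col j)) (A₄ (row x) (col j)) (A₃+A₄≤1 (row x) (col j))
    ; WWᵀ≡kI   = WWᵀ≡kI
    ; |W||W|ᵀ  = ∣W∣∣W∣ᵀ
    }

mainTheorem5 : ∀ {c ℓ : Level} (F : Field c ℓ) → FieldOps.CharacteristicZero F →
    (v k : ℕ) → 0 < k → k < v →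
    (s t a b c' : Field.Carrier F) →
    Field._≈_ F (Field._*_ F s s) (FieldOps.ι F k) →
    Field._≈_ F (Field._*_ F (FieldOps.ι F (v ∸ 1)) (Field._*_ F t t)) (FieldOps.ι F ((v ∸ k) * k)) →
    Field._≈_ F (Field._*_ F (FieldOps.ι F k) a) (Field._*_ F (FieldOps.ι F v) s) →
    Field._≈_ F (Field._*_ F (FieldOps.ι F k) b) (Field._*_ F (FieldOps.ι F (v ∸ 1)) t) →
    Field._≈_ F (Field._*_ F (FieldOps.ι F (v ∸ k)) c') (Field._*_ F (FieldOps.ι F (v ∸ 1)) t) →
    (N : ℕ) (A : Fin 6 → Fin N → Fin N → ℕ) →
    IsSymAssocScheme 5 N A →
    FieldOps.HasEigenmatrices F 5 N A (FieldOps.Pmat F v k s t) (FieldOps.Qmat F v a b c') →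
    ∃ λ (lam : ℕ) → (lam * (v ∸ 1) ≡ k * (k ∸ 1)) ×
      ∃ λ (W : Fin v → Fin v → ℤ) → IsBalancedWeighing v k lam W
mainTheorem5 F char0 v k 0<k k<v s t _ _ _ s² t² _ _ _ N A scheme eigenmatrices =
  Construction.balancedWeighing v k 0<k k<v scheme (EigenmatrixRelations.relations F char0 v k 0<k k<v s t s² t² eigenmatrices)
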